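{- For every $n\ge 2$, $$\sum_{\gamma\in D_n}t^{\operatorname{dmaj}(\gamma)}q^{\ell_D(\gamma)}=\sum_{\gamma\in D_n}t^{\ell_D(\gamma)}q^{\operatorname{dmaj}(\gamma)}.$$
   Context: $B_n$ is the group of bijections $\beta$ of $[-n,n]\setminus\{0\}$ with $\beta(-i)=-\beta(i)$, in window notation $[\beta(1),\dots,\beta(n)]$; $D_n\subseteq B_n$ is the subgroup of those with an even number of negative entries among $\beta(1),\dots,\beta(n)$. For $\gamma\in D_n$: $\operatorname{Des}(\gamma)=\{i\in[n-1]\mid\gamma(i)>\gamma(i+1)\}$, $\operatorname{maj}(\gamma)=\sum_{i\in\operatorname{Des}(\gamma)}i$, $\operatorname{inv}(\gamma)=|\{(i,j):1\le i<j\le n,\gamma(i)>\gamma(j)\}|$, $\operatorname{N}_2(\gamma)=|\{\{i,j\}\subseteq[n],i\ne j:\gamma(i)+\gamma(j)<0\}|$. $\ell_D(\gamma)=\operatorname{inv}(\gamma)+\operatorname{N}_2(\gamma)$ (the Coxeter length of type $D$) and $\operatorname{dmaj}(\gamma)=\operatorname{maj}(\gamma)+\operatorname{N}_2(\gamma)$. -}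

module Defs where

open import Data.Nat using (ℕ; zero; suc; _+_)
open import Data.Integer as ℤ using (ℤ; +_; -_; ∣_∣)
open import Data.Bool using (Bool; true; false; _∧_; not; if_then_else_)
open import Data.List using (List; []; _∷_; map; concatMap; filter; length; upTo)
open import Data.List using (all)
open import Data.Product using (_×_; _,_)
open import Relation.Nullary.Decidable using (⌊_⌋; _×-dec_)
open import Relation.Binary.PropositionalEquality using (_≡_)
open import Data.Nat.Properties using () renaming (_≟_ to _≟ℕ_)

-- Signed permutations are represented by their window [β(1),…,β(n)] : List ℤ.

signedValues : ℕ → List ℤ
signedValues n = concatMap (λ k → + suc k ∷ - (+ suc k) ∷ []) (upTo n)

words : ℕ → List ℤ → List (List ℤ)
words zero    xs = [] ∷ []
words (suc k) xs = concatMap (λ x → map (x ∷_) (words k xs)) xs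

infix 4 _<ᵇ_ _>ᵇ_

_<ᵇ_ : ℤ → ℤ → Bool
a <ᵇ b = ⌊ a ℤ.<? b ⌋

_>ᵇ_ : ℤ → ℤ → Bool
a >ᵇ b = b <ᵇ a

distinctAbs : List ℤ → Bool
distinctAbs []       = true
distinctAbs (x ∷ xs) = all (λ y → not ⌊ ∣ x ∣ ≟ℕ ∣ y ∣ ⌋) xs ∧ distinctAbs xs

negCount : List ℤ → ℕ
negCount []       = 0
negCount (x ∷ xs) = (if x <ᵇ (+ 0) then 1 else 0) + negCount xs

isEven : ℕ → Bool
isEven zero          = true
isEven (suc zero)    = false
isEven (suc (suc k)) = isEven k

-- B_n: windows of length n, entries in {±1,…,±n}, with distinct absolute
-- values (so |β(1)|,…,|β(n)| is a permutation of [n]).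
B : ℕ → List (List ℤ)
B n = filter (λ w → distinctAbs w Data.Bool.≟ true) (words n (signedValues n))

D : ℕ → List (List ℤ)
D n = filter (λ w → isEven (negCount w) Data.Bool.≟ true) (B n)

count : (ℤ → Bool) → List ℤ → ℕ
count p xs = length (filter (λ x → p x Data.Bool.≟ true) xs)

inv : List ℤ → ℕ
inv []       = 0
inv (x ∷ xs) = count (λ y → x >ᵇ y) xs + inv xs

N₂ : List ℤ → ℕ
N₂ []       = 0
N₂ (x ∷ xs) = count (λ y → (x ℤ.+ y) <ᵇ (+ 0)) xs + N₂ xs

majFrom : ℕ → List ℤ → ℕ
majFrom i []           = 0
majFrom i (x ∷ [])     = 0
majFrom i (x ∷ y ∷ xs) = (if x >ᵇ y then i else 0) + majFrom (suc i) (y ∷ xs)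

maj : List ℤ → ℕ
maj = majFrom 1

ℓD : List ℤ → ℕ
ℓD γ = inv γ + N₂ γ

dmaj : List ℤ → ℕ
dmaj γ = maj γ + N₂ γ

-- Coefficient of t^a q^b in  Σ_{γ ∈ D_n} t^{f γ} q^{g γ}.
coeff : ℕ → (List ℤ → ℕ) → (List ℤ → ℕ) → ℕ → ℕ → ℕ
coeff n f g a b =
  length (filter (λ γ → (f γ ≟ℕ a) ×-dec (g γ ≟ℕ b)) (D n))

module Submission where

-- Both dmaj = maj + N₂ and ℓD = inv + N₂ contain the summand N₂, which only
-- depends on the set of entries of a window, and D_n is closed under
-- rearranging windows.  So it suffices to have injective rearrangements of
-- windows (with distinct letters) carrying one pair of statistics to another;
-- the Foata–Schützenberger argument supplies two of them:
--   * Foata's second fundamental transformation Φ, with inv ∘ Φ = maj and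
--     imaj ∘ Φ = imaj, where imaj is the major index of the inverse;
--   * the inverse ι of a word (standardise, invert, restore the letters), an
--     involution with inv ∘ ι = inv, maj ∘ ι = imaj and imaj ∘ ι = maj.
-- Counting along them gives the chain of equidistributions
--   (maj, inv) ~ (imaj, inv) ~ (imaj, maj) ~ (maj, imaj) ~ (inv, imaj) ~ (inv, maj).

open import Defs

open import Level using (0ℓ)
open import Function using (_∘_; id)
open import Function.Bundles using (_⇔_; mk⇔; Equivalence)
open import Data.Empty using (⊥; ⊥-elim)
open import Data.Product using (_×_; _,_; proj₁; proj₂; ∃)
import Data.Product
open import Data.Sum using (_⊎_; inj₁; inj₂)
open import Data.Bool using (Bool; true; false; if_then_else_; not; _∧_; _∨_; T)
import Data.Bool
open import Data.Bool.Properties using (∧-comm; T-≡)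
open import Data.Nat as ℕ using (ℕ; zero; suc; _+_; _≤_; _<_; z≤n; s≤s)
import Data.Nat.Properties as ℕP
open import Data.Nat.ListAction using (sum)
open import Data.Nat.ListAction.Properties using (sum-↭; sum-++)
open import Data.Nat.Solver using (module +-*-Solver)
open import Data.Integer as ℤ using (ℤ)
import Data.Integer.Properties as ℤP
open import Data.List using (List; []; _∷_; [_]; _++_; map; filter; length; reverse; all; upTo; applyUpTo)
import Data.List.Properties as LP
open import Data.List.Membership.Propositional using (_∈_)
import Data.List.Membership.Propositional.Properties as ∈P
open import Data.List.Relation.Unary.Any using (here; there)
open import Data.List.Relation.Unary.All as All using (All; []; _∷_)
import Data.List.Relation.Unary.All.Properties as AllP
open import Data.List.Relation.Unary.AllPairs as AllPairs using (AllPairs; []; _∷_)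
import Data.List.Relation.Unary.AllPairs.Properties as AllPairsP
open import Data.List.Relation.Unary.Unique.Propositional using (Unique)
import Data.List.Relation.Unary.Unique.Propositional.Properties as UniqueP
open import Data.List.Relation.Binary.Disjoint.Propositional using (Disjoint)
open import Data.List.Relation.Binary.Permutation.Propositional
  using (_↭_; prep; ↭-refl; ↭-sym; ↭-trans; ↭-reflexive; ↭⇒↭ₛ)
import Data.List.Relation.Binary.Permutation.Propositional.Properties as ↭P
import Data.List.Relation.Binary.Permutation.Setoid.Properties as ↭ₛP
open import Relation.Nullary using (¬_; Dec; yes; no)
open import Relation.Nullary.Decidable using (⌊_⌋; _×-dec_)
open import Relation.Unary using (Pred; Decidable)
open import Relation.Binary.Definitions using (tri<; tri≈; tri>)
open import Relation.Binary.PropositionalEquality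
  using (_≡_; _≢_; refl; sym; trans; cong; cong₂; subst; module ≡-Reasoning)
import Relation.Binary.PropositionalEquality as ≡

open +-*-Solver using (solve; _:=_; _:+_)

private variable
  A A′ : Set

sumL : (A → ℕ) → List A → ℕ
sumL f xs = sum (map f xs)

indicator : Bool → ℕ
indicator b = if b then 1 else 0

cnt : (A → Bool) → List A → ℕ
cnt p = sumL (λ x → indicator (p x))

sumL-↭ : (f : A → ℕ) {xs ys : List A} → xs ↭ ys → sumL f xs ≡ sumL f ys
sumL-↭ f p = sum-↭ (↭P.map⁺ f p)

cnt-↭ : (p : A → Bool) {xs ys : List A} → xs ↭ ys → cnt p xs ≡ cnt p ys
cnt-↭ p = sumL-↭ (λ x → indicator (p x))

sumL-cong : {f g : A → ℕ} (xs : List A) → (∀ {x} → x ∈ xs → f x ≡ g x) → sumL f xs ≡ sumL g xs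
sumL-cong []       h = refl
sumL-cong (x ∷ xs) h = cong₂ _+_ (h (here refl)) (sumL-cong xs (h ∘ there))

cnt-cong : {p q : A → Bool} (xs : List A) → (∀ {x} → x ∈ xs → p x ≡ q x) → cnt p xs ≡ cnt q xs
cnt-cong xs h = sumL-cong xs (cong indicator ∘ h)

sumL-map : (f : A′ → ℕ) (h : A → A′) (xs : List A) → sumL f (map h xs) ≡ sumL (f ∘ h) xs
sumL-map f h xs = cong sum (sym (LP.map-∘ xs))

sumL-+ : (f g : A → ℕ) (xs : List A) → sumL (λ x → f x + g x) xs ≡ sumL f xs + sumL g xs
sumL-+ f g []       = refl
sumL-+ f g (x ∷ xs) = trans (cong (f x + g x +_) (sumL-+ f g xs))
  (solve 4 (λ a b c d → (a :+ b) :+ (c :+ d) := (a :+ c) :+ (b :+ d)) refl (f x) (g x) (sumL f xs) (sumL g xs))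

sumL-swap : (f : A → A′ → ℕ) (xs : List A) (ys : List A′) →
  sumL (λ a → sumL (f a) ys) xs ≡ sumL (λ b → sumL (λ a → f a b) xs) ys
sumL-swap f []       ys = sym (zeros ys)
  where
    zeros : (ys : List _) → sumL (λ _ → 0) ys ≡ 0
    zeros []       = refl
    zeros (_ ∷ ys) = zeros ys
sumL-swap f (x ∷ xs) ys = trans (cong (sumL (f x) ys +_) (sumL-swap f xs ys))
  (sym (sumL-+ (f x) (λ b → sumL (λ a → f a b) xs) ys))

cnt-++ : (p : A → Bool) (xs ys : List A) → cnt p (xs ++ ys) ≡ cnt p xs + cnt p ys
cnt-++ p xs ys = trans (cong sum (LP.map-++ _ xs ys)) (sum-++ (map _ xs) (map _ ys))

cnt-all-true : (p : A → Bool) (xs : List A) → All (λ x → p x ≡ true) xs → cnt p xs ≡ length xs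
cnt-all-true p []       []       = refl
cnt-all-true p (x ∷ xs) (e ∷ es) rewrite e = cong suc (cnt-all-true p xs es)

cnt-all-false : (p : A → Bool) (xs : List A) → All (λ x → p x ≡ false) xs → cnt p xs ≡ 0
cnt-all-false p []       []       = refl
cnt-all-false p (x ∷ xs) (e ∷ es) rewrite e = cnt-all-false p xs es

cnt-not : (p : A → Bool) (xs : List A) → cnt (not ∘ p) xs + cnt p xs ≡ length xs
cnt-not p []       = refl
cnt-not p (x ∷ xs) with p x
... | true  = trans (ℕP.+-suc _ _) (cong suc (cnt-not p xs))
... | false = cong suc (cnt-not p xs)

cnt-mono : (p q : A → Bool) (xs : List A) → (∀ {y} → p y ≡ true → q y ≡ true) → cnt p xs ≤ cnt q xs
cnt-mono p q []       h = z≤n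
cnt-mono p q (x ∷ xs) h with p x in ep | q x in eq
... | true  | true  = s≤s (cnt-mono p q xs h)
... | false | true  = ℕP.m≤n⇒m≤1+n (cnt-mono p q xs h)
... | false | false = cnt-mono p q xs h
... | true  | false with () ← trans (sym (h ep)) eq

cnt-strict : (p q : A → Bool) (xs : List A) → (∀ {y} → p y ≡ true → q y ≡ true) →
  ∀ {z} → z ∈ xs → p z ≡ false → q z ≡ true → cnt p xs < cnt q xs
cnt-strict p q (x ∷ xs) h (here refl) pz qz rewrite pz | qz = s≤s (cnt-mono p q xs h)
cnt-strict p q (x ∷ xs) h (there m) pz qz with p x in ep | q x in eq
... | true  | true  = s≤s (cnt-strict p q xs h m pz qz)
... | false | true  = ℕP.m≤n⇒m≤1+n (cnt-strict p q xs h m pz qz)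
... | false | false = cnt-strict p q xs h m pz qz
... | true  | false with () ← trans (sym (h ep)) eq

count≡cnt : (p : ℤ → Bool) (xs : List ℤ) → count p xs ≡ cnt p xs
count≡cnt p []       = refl
count≡cnt p (x ∷ xs) with p x
... | true  = cong suc (count≡cnt p xs)
... | false = count≡cnt p xs

unique-⊆⇒↭ : {xs ys : List A} → Unique xs → (∀ {z} → z ∈ xs → z ∈ ys) → length ys ≤ length xs → xs ↭ ys
unique-⊆⇒↭ {xs = []}     {[]}    _ _ _  = ↭-refl
unique-⊆⇒↭ {xs = []}     {_ ∷ _} _ _ ()
unique-⊆⇒↭ {xs = x ∷ xs} {ys} (x∉xs ∷ u) sub len with ∈P.∈-∃++ (sub (here refl))
... | h , t , refl = ↭-trans (prep x (unique-⊆⇒↭ u sub′ len′)) (↭-sym (↭P.shift x h t))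
  where
    sub′ : ∀ {z} → z ∈ xs → z ∈ h ++ t
    sub′ {z} m with ∈P.∈-++⁻ h (sub (there m))
    ... | inj₁ mh          = ∈P.∈-++⁺ˡ mh
    ... | inj₂ (here refl) = ⊥-elim (All.lookup x∉xs m refl)
    ... | inj₂ (there mt)  = ∈P.∈-++⁺ʳ h mt
    removed : length (h ++ x ∷ t) ≡ suc (length (h ++ t))
    removed = trans (LP.length-++ h) (trans (ℕP.+-suc _ _) (cong suc (sym (LP.length-++ h))))
    len′ : length (h ++ t) ≤ length xs
    len′ = ℕP.≤-pred (subst (_≤ suc (length xs)) removed len)

map-unique : (f : A → A′) {xs : List A} → Unique xs →
  (∀ {x y} → x ∈ xs → y ∈ xs → f x ≡ f y → x ≡ y) → Unique (map f xs)
map-unique f {[]}     []      inj = []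
map-unique f {x ∷ xs} (a ∷ u) inj =
  AllP.map⁺ (All.tabulate (λ {y} m fx≡fy → All.lookup a m (inj (here refl) (there m) fx≡fy)))
  ∷ map-unique f u (λ mx my → inj (there mx) (there my))

filter-map-length : {P : Pred A′ 0ℓ} (P? : Decidable P) (f : A → A′) (xs : List A) →
  length (filter P? (map f xs)) ≡ length (filter (P? ∘ f) xs)
filter-map-length P? f []       = refl
filter-map-length P? f (x ∷ xs) with P? (f x)
... | yes _ = cong suc (filter-map-length P? f xs)
... | no _  = filter-map-length P? f xs

filter-length-cong : {P Q : Pred A 0ℓ} (P? : Decidable P) (Q? : Decidable Q) (xs : List A) →
  (∀ {x} → x ∈ xs → (P x → Q x) × (Q x → P x)) → length (filter P? xs) ≡ length (filter Q? xs)
filter-length-cong P? Q? []       h = refl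
filter-length-cong P? Q? (x ∷ xs) h with P? x | Q? x
... | yes _ | yes _ = cong suc (filter-length-cong P? Q? xs (h ∘ there))
... | no _  | no _  = filter-length-cong P? Q? xs (h ∘ there)
... | yes p | no ¬q = ⊥-elim (¬q (proj₁ (h (here refl)) p))
... | no ¬p | yes q = ⊥-elim (¬p (proj₂ (h (here refl)) q))

-- A self-map σ of a duplicate-free list L that is injective on L permutes L, so
-- counting P on L is the same as counting P ∘ σ on L.
filter-length-injection : {P : Pred A 0ℓ} (P? : Decidable P) (L : List A) (σ : A → A) → Unique L →
  (∀ {x} → x ∈ L → σ x ∈ L) → (∀ {x y} → x ∈ L → y ∈ L → σ x ≡ σ y → x ≡ y) →
  length (filter P? L) ≡ length (filter (P? ∘ σ) L)
filter-length-injection P? L σ u into inj =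
  trans (sym (↭P.↭-length (↭P.filter-↭ P? σL↭L))) (filter-map-length P? σ L)
  where
    image⊆L : ∀ {z} → z ∈ map σ L → z ∈ L
    image⊆L m with ∈P.∈-map⁻ σ m
    ... | x , mx , refl = into mx
    σL↭L : map σ L ↭ L
    σL↭L = unique-⊆⇒↭ (map-unique σ u inj) image⊆L (ℕP.≤-reflexive (sym (LP.length-map σ L)))

<ᵇ⇒< : ∀ {a b} → (a <ᵇ b) ≡ true → a ℤ.< b
<ᵇ⇒< {a} {b} e with a ℤ.<? b
... | yes a<b = a<b

<ᵇ≡false⇒≮ : ∀ {a b} → (a <ᵇ b) ≡ false → ¬ a ℤ.< b
<ᵇ≡false⇒≮ {a} {b} e with a ℤ.<? b
... | no a≮b = a≮b

<⇒<ᵇ : ∀ {a b} → a ℤ.< b → (a <ᵇ b) ≡ true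
<⇒<ᵇ {a} {b} a<b with a ℤ.<? b
... | yes _  = refl
... | no a≮b = ⊥-elim (a≮b a<b)

≮⇒<ᵇ≡false : ∀ {a b} → ¬ a ℤ.< b → (a <ᵇ b) ≡ false
≮⇒<ᵇ≡false {a} {b} a≮b with a ℤ.<? b
... | yes a<b = ⊥-elim (a≮b a<b)
... | no _    = refl

<ᵇ-irrefl : ∀ a → (a <ᵇ a) ≡ false
<ᵇ-irrefl a = ≮⇒<ᵇ≡false (ℤP.<-irrefl refl)

<ᵇ-asym : ∀ {a b} → (a <ᵇ b) ≡ true → (b <ᵇ a) ≡ false
<ᵇ-asym e = ≮⇒<ᵇ≡false (ℤP.<-asym (<ᵇ⇒< e))

<ᵇ-flip : ∀ {a b} → a ≢ b → (a <ᵇ b) ≡ not (b <ᵇ a)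
<ᵇ-flip {a} {b} a≢b with a ℤ.<? b | b ℤ.<? a
... | yes a<b | yes b<a = ⊥-elim (ℤP.<-asym a<b b<a)
... | yes _   | no _    = refl
... | no _    | yes _   = refl
... | no a≮b  | no b≮a  = ⊥-elim (a≮b (ℤP.≤∧≢⇒< (ℤP.≮⇒≥ b≮a) a≢b))

≮-<-trans : ∀ {a x b} → (x <ᵇ a) ≡ false → (x <ᵇ b) ≡ true → (a <ᵇ b) ≡ true
≮-<-trans e₁ e₂ = <⇒<ᵇ (ℤP.≤-<-trans (ℤP.≮⇒≥ (<ᵇ≡false⇒≮ e₁)) (<ᵇ⇒< e₂))

<-≮-trans : ∀ {a x b} → (b <ᵇ x) ≡ true → (a <ᵇ x) ≡ false → (b <ᵇ a) ≡ true
<-≮-trans e₁ e₂ = <⇒<ᵇ (ℤP.<-≤-trans (<ᵇ⇒< e₁) (ℤP.≮⇒≥ (<ᵇ≡false⇒≮ e₂)))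

⌊⌋-⇔ : {P Q : Set} → P ⇔ Q → (p? : Dec P) (q? : Dec Q) → ⌊ p? ⌋ ≡ ⌊ q? ⌋
⌊⌋-⇔ P⇔Q (yes p) (yes q) = refl
⌊⌋-⇔ P⇔Q (no ¬p) (no ¬q) = refl
⌊⌋-⇔ P⇔Q (yes p) (no ¬q) = ⊥-elim (¬q (Equivalence.to P⇔Q p))
⌊⌋-⇔ P⇔Q (no ¬p) (yes q) = ⊥-elim (¬p (Equivalence.from P⇔Q q))

-- No integer lies strictly between k and k+1: any x different from both lies
-- on the same side of each.
between-consecutive : ∀ x k → x ≢ ℤ.+ k → x ≢ ℤ.+ suc k →
  ((x <ᵇ ℤ.+ k) ≡ (x <ᵇ ℤ.+ suc k)) × ((ℤ.+ k <ᵇ x) ≡ (ℤ.+ suc k <ᵇ x))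
between-consecutive x k x≢k x≢k+1 = ⌊⌋-⇔ below (x ℤ.<? ℤ.+ k) (x ℤ.<? ℤ.+ suc k)
                                  , ⌊⌋-⇔ above (ℤ.+ k ℤ.<? x) (ℤ.+ suc k ℤ.<? x)
  where
    k<k+1 : ℤ.+ k ℤ.< ℤ.+ suc k
    k<k+1 = ℤ.+<+ (ℕP.n<1+n k)
    below : (x ℤ.< ℤ.+ k) ⇔ (x ℤ.< ℤ.+ suc k)
    below = mk⇔ (λ x<k → ℤP.<-trans x<k k<k+1) (λ x<k+1 → ℤP.≤∧≢⇒< (≤-of-< x<k+1) x≢k)
      where
        ≤-of-< : ∀ {y} → y ℤ.< ℤ.+ suc k → y ℤ.≤ ℤ.+ k
        ≤-of-< (ℤ.+<+ (s≤s m≤k)) = ℤ.+≤+ m≤k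
        ≤-of-< ℤ.-<+              = ℤ.-≤+
    above : (ℤ.+ k ℤ.< x) ⇔ (ℤ.+ suc k ℤ.< x)
    above = mk⇔ (λ k<x → ℤP.≤∧≢⇒< (suc≤-of-< k<x) (x≢k+1 ∘ sym))
                (λ k+1<x → ℤP.<-trans k<k+1 k+1<x)
      where
        suc≤-of-< : ∀ {y} → ℤ.+ k ℤ.< y → ℤ.+ suc k ℤ.≤ y
        suc≤-of-< (ℤ.+<+ k<m) = ℤ.+≤+ k<m

<ᵇ-ℕ : (m n : ℕ) → (ℤ.+ m <ᵇ ℤ.+ n) ≡ (m ℕ.<ᵇ n)
<ᵇ-ℕ m n = go (m ℕ.<ᵇ n) refl
  where
    go : ∀ b → (m ℕ.<ᵇ n) ≡ b → (ℤ.+ m <ᵇ ℤ.+ n) ≡ b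
    go true  e = <⇒<ᵇ (ℤ.+<+ (ℕP.<ᵇ⇒< m n (subst T (sym e) _)))
    go false e = ≮⇒<ᵇ≡false (λ { (ℤ.+<+ m<n) → subst T e (ℕP.<⇒<ᵇ m<n) })

allPairs-↭ : {R : A → A → Set} → (∀ {x y} → R x y → R y x) → {xs ys : List A} →
  xs ↭ ys → AllPairs R xs → AllPairs R ys
allPairs-↭ {A = A} sym-R p =
  ↭ₛP.AllPairs-resp-↭ (≡.setoid A) sym-R ((λ { refl r → r }) , (λ { refl r → r })) (↭⇒↭ₛ p)

unique-↭ : {xs ys : List A} → xs ↭ ys → Unique xs → Unique ys
unique-↭ = allPairs-↭ (λ x≢y → x≢y ∘ sym)

negCount≡cnt : (w : List ℤ) → negCount w ≡ cnt (_<ᵇ ℤ.+ 0) w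
negCount≡cnt []      = refl
negCount≡cnt (x ∷ w) = cong (indicator (x <ᵇ ℤ.+ 0) +_) (negCount≡cnt w)

negCount-↭ : {w w′ : List ℤ} → w ↭ w′ → negCount w ≡ negCount w′
negCount-↭ {w} {w′} p = trans (negCount≡cnt w) (trans (cnt-↭ _ p) (sym (negCount≡cnt w′)))

AbsDistinct : ℤ → ℤ → Set
AbsDistinct x y = ℤ.∣ x ∣ ≢ ℤ.∣ y ∣

all≡true⇒All : (p : A → Bool) (xs : List A) → all p xs ≡ true → All (λ x → p x ≡ true) xs
all≡true⇒All p []       e = []
all≡true⇒All p (x ∷ xs) e with p x in px
... | true = px ∷ all≡true⇒All p xs e

All⇒all≡true : (p : A → Bool) (xs : List A) → All (λ x → p x ≡ true) xs → all p xs ≡ true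
All⇒all≡true p []       []       = refl
All⇒all≡true p (x ∷ xs) (e ∷ es) rewrite e = All⇒all≡true p xs es

≢⇔not⌊≟⌋ : (m n : ℕ) → (m ≢ n) ⇔ (not ⌊ m ℕ.≟ n ⌋ ≡ true)
≢⇔not⌊≟⌋ m n with m ℕ.≟ n
... | yes m≡n = mk⇔ (λ m≢n → ⊥-elim (m≢n m≡n)) (λ ())
... | no m≢n  = mk⇔ (λ _ → refl) (λ _ → m≢n)

distinctAbs⇒AllPairs : (w : List ℤ) → distinctAbs w ≡ true → AllPairs AbsDistinct w
distinctAbs⇒AllPairs []      e = []
distinctAbs⇒AllPairs (x ∷ w) e with all (λ y → not ⌊ ℤ.∣ x ∣ ℕ.≟ ℤ.∣ y ∣ ⌋) w in head
... | true = All.map (λ {y} → Equivalence.from (≢⇔not⌊≟⌋ ℤ.∣ x ∣ ℤ.∣ y ∣)) (all≡true⇒All _ w head)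
           ∷ distinctAbs⇒AllPairs w e

AllPairs⇒distinctAbs : (w : List ℤ) → AllPairs AbsDistinct w → distinctAbs w ≡ true
AllPairs⇒distinctAbs []      []       = refl
AllPairs⇒distinctAbs (x ∷ w) (a ∷ as)
  rewrite All⇒all≡true _ w (All.map (λ {y} → Equivalence.to (≢⇔not⌊≟⌋ ℤ.∣ x ∣ ℤ.∣ y ∣)) a) =
  AllPairs⇒distinctAbs w as

distinctAbs⇒Unique : (w : List ℤ) → distinctAbs w ≡ true → Unique w
distinctAbs⇒Unique w e = AllPairs.map (λ ne eq → ne (cong ℤ.∣_∣ eq)) (distinctAbs⇒AllPairs w e)

distinctAbs-↭ : {w w′ : List ℤ} → w ↭ w′ → distinctAbs w ≡ true → distinctAbs w′ ≡ true
distinctAbs-↭ {w} {w′} p e =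
  AllPairs⇒distinctAbs w′ (allPairs-↭ (λ ne → ne ∘ sym) p (distinctAbs⇒AllPairs w e))

words⁻ : (k : ℕ) (xs w : List ℤ) → w ∈ words k xs → (length w ≡ k) × All (_∈ xs) w
words⁻ zero    xs .[] (here refl) = refl , []
words⁻ (suc k) xs w m
  with vs , mw , mvs ← ∈P.∈-concat⁻′ (map (λ x → map (x ∷_) (words k xs)) xs) m
  with x , mx , refl ← ∈P.∈-map⁻ (λ x → map (x ∷_) (words k xs)) mvs
  with w′ , mw′ , refl ← ∈P.∈-map⁻ (x ∷_) mw
  with len , entries ← words⁻ k xs w′ mw′ = cong suc len , mx ∷ entries

words⁺ : (k : ℕ) (xs w : List ℤ) → length w ≡ k → All (_∈ xs) w → w ∈ words k xs
words⁺ zero    xs []      refl []        = here refl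
words⁺ (suc k) xs (x ∷ w) refl (mx ∷ es) =
  ∈P.∈-concat⁺′ (∈P.∈-map⁺ (x ∷_) (words⁺ k xs w refl es)) (∈P.∈-map⁺ (λ x → map (x ∷_) (words k xs)) mx)

record InD (n : ℕ) (w : List ℤ) : Set where
  field
    length≡ : length w ≡ n
    entries : All (_∈ signedValues n) w
    absDistinct : distinctAbs w ≡ true
    evenNeg : isEven (negCount w) ≡ true

∈D⇒InD : (n : ℕ) (w : List ℤ) → w ∈ D n → InD n w
∈D⇒InD n w m
  with m₁ , ev ← ∈P.∈-filter⁻ (λ w → isEven (negCount w) Data.Bool.≟ true) m
  with m₂ , da ← ∈P.∈-filter⁻ (λ w → distinctAbs w Data.Bool.≟ true) m₁
  with len , es ← words⁻ n (signedValues n) w m₂ = record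
    { length≡ = len ; entries = es ; absDistinct = da ; evenNeg = ev }

InD⇒∈D : (n : ℕ) (w : List ℤ) → InD n w → w ∈ D n
InD⇒∈D n w r = ∈P.∈-filter⁺ (λ w → isEven (negCount w) Data.Bool.≟ true)
  (∈P.∈-filter⁺ (λ w → distinctAbs w Data.Bool.≟ true)
     (words⁺ n (signedValues n) w (InD.length≡ r) (InD.entries r)) (InD.absDistinct r))
  (InD.evenNeg r)

∈D⇒Unique : (n : ℕ) {w : List ℤ} → w ∈ D n → Unique w
∈D⇒Unique n {w} m = distinctAbs⇒Unique w (InD.absDistinct (∈D⇒InD n w m))

∈D-↭ : (n : ℕ) {w w′ : List ℤ} → w ↭ w′ → w ∈ D n → w′ ∈ D n
∈D-↭ n {w} {w′} p m = InD⇒∈D n w′ (record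
  { length≡ = trans (sym (↭P.↭-length p)) (InD.length≡ r)
  ; entries = ↭P.All-resp-↭ p (InD.entries r)
  ; absDistinct = distinctAbs-↭ p (InD.absDistinct r)
  ; evenNeg = trans (cong isEven (sym (negCount-↭ p))) (InD.evenNeg r) })
  where r = ∈D⇒InD n w m

words-unique : (k : ℕ) (xs : List ℤ) → Unique xs → Unique (words k xs)
words-unique zero    xs u = [] ∷ []
words-unique (suc k) xs u = UniqueP.concat⁺ (blocks xs) (AllPairsP.map⁺ (AllPairs.map disjoint u))
  where
    blocks : (ys : List ℤ) → All Unique (map (λ x → map (x ∷_) (words k xs)) ys)
    blocks []       = []
    blocks (y ∷ ys) = map-unique (y ∷_) (words-unique k xs u) (λ _ _ → proj₂ ∘ LP.∷-injective) ∷ blocks ys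
    disjoint : ∀ {x y} → x ≢ y → Disjoint (map (x ∷_) (words k xs)) (map (y ∷_) (words k xs))
    disjoint x≢y (m₁ , m₂) with _ , _ , refl ← ∈P.∈-map⁻ _ m₁ | _ , _ , e ← ∈P.∈-map⁻ _ m₂ =
      x≢y (proj₁ (LP.∷-injective e))

signedValues-unique : (n : ℕ) → Unique (signedValues n)
signedValues-unique n = UniqueP.concat⁺ (blocks (upTo n)) (AllPairsP.map⁺ (AllPairs.map disjoint (UniqueP.upTo⁺ n)))
  where
    pair : ℕ → List ℤ
    pair k = ℤ.+ suc k ∷ ℤ.- (ℤ.+ suc k) ∷ []
    blocks : (ks : List ℕ) → All Unique (map pair ks)
    blocks []       = []
    blocks (k ∷ ks) = (((λ ()) ∷ []) ∷ [] ∷ []) ∷ blocks ks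
    disjoint : ∀ {k l} → k ≢ l → Disjoint (pair k) (pair l)
    disjoint k≢l (here refl         , here refl)         = k≢l refl
    disjoint k≢l (there (here refl) , there (here refl)) = k≢l refl
    disjoint k≢l (here refl         , there (here ()))
    disjoint k≢l (there (here refl) , here ())

D-unique : (n : ℕ) → Unique (D n)
D-unique n = UniqueP.filter⁺ _ (UniqueP.filter⁺ _ (words-unique n (signedValues n) (signedValues-unique n)))

inv-∷ : (x : ℤ) (xs : List ℤ) → inv (x ∷ xs) ≡ cnt (x >ᵇ_) xs + inv xs
inv-∷ x xs = cong (_+ inv xs) (count≡cnt _ xs)

negSum : ℤ → ℤ → Bool
negSum x z = (x ℤ.+ z) <ᵇ ℤ.+ 0

N₂-∷ : (x : ℤ) (xs : List ℤ) → N₂ (x ∷ xs) ≡ cnt (negSum x) xs + N₂ xs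
N₂-∷ x xs = cong (_+ N₂ xs) (count≡cnt _ xs)

N₂-↭ : {w w′ : List ℤ} → w ↭ w′ → N₂ w ≡ N₂ w′
N₂-↭ (_↭_.refl)            = refl
N₂-↭ (_↭_.trans p q)       = trans (N₂-↭ p) (N₂-↭ q)
N₂-↭ (prep {xs} {ys} x p)  = trans (N₂-∷ x xs) (trans (cong₂ _+_ (cnt-↭ _ p) (N₂-↭ p)) (sym (N₂-∷ x ys)))
N₂-↭ (_↭_.swap {xs} {ys} x y p) = begin
    N₂ (x ∷ y ∷ xs)
      ≡⟨ trans (N₂-∷ x (y ∷ xs)) (cong (cnt (negSum x) (y ∷ xs) +_) (N₂-∷ y xs)) ⟩
    (b + cnt (negSum x) xs) + (cnt (negSum y) xs + N₂ xs)
      ≡⟨ cong₂ (λ c d → (b + c) + d) (cnt-↭ _ p) (cong₂ _+_ (cnt-↭ _ p) (N₂-↭ p)) ⟩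
    (b + cnt (negSum x) ys) + (cnt (negSum y) ys + N₂ ys)
      ≡⟨ solve 4 (λ b c d e → (b :+ c) :+ (d :+ e) := (b :+ d) :+ (c :+ e)) refl b _ _ (N₂ ys) ⟩
    (b + cnt (negSum y) ys) + (cnt (negSum x) ys + N₂ ys)
      ≡⟨ cong (λ c → (c + cnt (negSum y) ys) + (cnt (negSum x) ys + N₂ ys)) b≡b′ ⟩
    (b′ + cnt (negSum y) ys) + (cnt (negSum x) ys + N₂ ys)
      ≡⟨ sym (trans (N₂-∷ y (x ∷ ys)) (cong (cnt (negSum y) (x ∷ ys) +_) (N₂-∷ x ys))) ⟩
    N₂ (y ∷ x ∷ ys)
      ∎
  where
    open ≡-Reasoning
    b b′ : ℕ
    b  = indicator (negSum x y)
    b′ = indicator (negSum y x)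
    b≡b′ : b ≡ b′
    b≡b′ = cong (λ z → indicator (z <ᵇ ℤ.+ 0)) (ℤP.+-comm x y)

OrderPreserving : (ℤ → ℤ) → List ℤ → Set
OrderPreserving f L = ∀ {a b} → a ∈ L → b ∈ L → (f a <ᵇ f b) ≡ (a <ᵇ b)

cnt-map : (p : A′ → Bool) (f : A → A′) (xs : List A) → cnt p (map f xs) ≡ cnt (p ∘ f) xs
cnt-map p f = sumL-map (λ x → indicator (p x)) f

inv-relabel : (f : ℤ → ℤ) (L : List ℤ) → OrderPreserving f L → inv (map f L) ≡ inv L
inv-relabel f []      op = refl
inv-relabel f (x ∷ L) op = begin
    inv (f x ∷ map f L)                      ≡⟨ inv-∷ (f x) (map f L) ⟩
    cnt (f x >ᵇ_) (map f L) + inv (map f L)  ≡⟨ cong₂ _+_ (trans (cnt-map _ f L) (cnt-cong L (λ m → op (there m) (here refl))))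
                                                          (inv-relabel f L (λ ma mb → op (there ma) (there mb))) ⟩
    cnt (x >ᵇ_) L + inv L                    ≡⟨ sym (inv-∷ x L) ⟩
    inv (x ∷ L)                              ∎
  where open ≡-Reasoning

majBy : (ℤ → ℤ → Bool) → ℕ → List ℤ → ℕ
majBy R i []           = 0
majBy R i (x ∷ [])     = 0
majBy R i (x ∷ y ∷ xs) = (if R x y then i else 0) + majBy R (suc i) (y ∷ xs)

majFrom≡majBy : (i : ℕ) (L : List ℤ) → majFrom i L ≡ majBy _>ᵇ_ i L
majFrom≡majBy i []           = refl
majFrom≡majBy i (x ∷ [])     = refl
majFrom≡majBy i (x ∷ y ∷ L)  = cong (_ +_) (majFrom≡majBy (suc i) (y ∷ L))

majBy-map : (R : ℤ → ℤ → Bool) (f : ℤ → ℤ) (i : ℕ) (L : List ℤ) →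
  majBy R i (map f L) ≡ majBy (λ a b → R (f a) (f b)) i L
majBy-map R f i []          = refl
majBy-map R f i (x ∷ [])    = refl
majBy-map R f i (x ∷ y ∷ L) = cong (_ +_) (majBy-map R f (suc i) (y ∷ L))

data Adjacent (a b : ℤ) : List ℤ → Set where
  here  : ∀ {L} → Adjacent a b (a ∷ b ∷ L)
  there : ∀ {x L} → Adjacent a b L → Adjacent a b (x ∷ L)

Adjacent⇒∈₁ : ∀ {a b L} → Adjacent a b L → a ∈ L
Adjacent⇒∈₁ here      = here refl
Adjacent⇒∈₁ (there c) = there (Adjacent⇒∈₁ c)

Adjacent⇒∈₂ : ∀ {a b L} → Adjacent a b L → b ∈ L
Adjacent⇒∈₂ here      = there (here refl)
Adjacent⇒∈₂ (there c) = there (Adjacent⇒∈₂ c)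

majBy-cong : (R R′ : ℤ → ℤ → Bool) (i : ℕ) (L : List ℤ) →
  (∀ {a b} → Adjacent a b L → R a b ≡ R′ a b) → majBy R i L ≡ majBy R′ i L
majBy-cong R R′ i []          h = refl
majBy-cong R R′ i (x ∷ [])    h = refl
majBy-cong R R′ i (x ∷ y ∷ L) h =
  cong₂ _+_ (cong (λ b → if b then i else 0) (h here)) (majBy-cong R R′ (suc i) (y ∷ L) (h ∘ there))

maj-relabel : (f : ℤ → ℤ) (L : List ℤ) → OrderPreserving f L → maj (map f L) ≡ maj L
maj-relabel f L op = begin
    maj (map f L)                        ≡⟨ majFrom≡majBy 1 (map f L) ⟩
    majBy _>ᵇ_ 1 (map f L)               ≡⟨ majBy-map _>ᵇ_ f 1 L ⟩
    majBy (λ a b → f a >ᵇ f b) 1 L       ≡⟨ majBy-cong _ _ 1 L (λ c → op (Adjacent⇒∈₂ c) (Adjacent⇒∈₁ c)) ⟩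
    majBy _>ᵇ_ 1 L                       ≡⟨ sym (majFrom≡majBy 1 L) ⟩
    maj L                                ∎
  where open ≡-Reasoning

cross : List ℤ → List ℤ → ℕ
cross A B = sumL (λ a → cnt (a >ᵇ_) B) A

cross-↭ : {A A′ B B′ : List ℤ} → A ↭ A′ → B ↭ B′ → cross A B ≡ cross A′ B′
cross-↭ {A′ = A′} p q = trans (sumL-↭ _ p) (sumL-cong A′ (λ _ → cnt-↭ _ q))

inv-++ : (A B : List ℤ) → inv (A ++ B) ≡ (inv A + cross A B) + inv B
inv-++ []      B = refl
inv-++ (a ∷ A) B = begin
    inv (a ∷ A ++ B)                                                ≡⟨ inv-∷ a (A ++ B) ⟩
    cnt (a >ᵇ_) (A ++ B) + inv (A ++ B)                             ≡⟨ cong₂ _+_ (cnt-++ _ A B) (inv-++ A B) ⟩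
    (cnt (a >ᵇ_) A + cnt (a >ᵇ_) B) + ((inv A + cross A B) + inv B)
      ≡⟨ solve 5 (λ p q r s t → (p :+ q) :+ ((r :+ s) :+ t) := ((p :+ r) :+ (q :+ s)) :+ t) refl
               (cnt (a >ᵇ_) A) (cnt (a >ᵇ_) B) (inv A) (cross A B) (inv B) ⟩
    ((cnt (a >ᵇ_) A + inv A) + cross (a ∷ A) B) + inv B             ≡⟨ cong (λ z → (z + cross (a ∷ A) B) + inv B) (sym (inv-∷ a A)) ⟩
    (inv (a ∷ A) + cross (a ∷ A) B) + inv B                         ∎
  where open ≡-Reasoning

inv-∷ʳ : (A : List ℤ) (x : ℤ) → inv (A ++ [ x ]) ≡ inv A + cnt (_>ᵇ x) A
inv-∷ʳ A x = trans (inv-++ A [ x ]) (trans (ℕP.+-identityʳ _) (cong (inv A +_) (sumL-cong A (λ _ → ℕP.+-identityʳ _))))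

majBy-∷ʳ : (R : ℤ → ℤ → Bool) (i : ℕ) (u : List ℤ) (y x : ℤ) →
  majBy R i (u ++ y ∷ x ∷ []) ≡ majBy R i (u ++ [ y ]) + (if R y x then i + length u else 0)
majBy-∷ʳ R i [] y x = trans (ℕP.+-identityʳ _) (cong (λ k → if R y x then k else 0) (sym (ℕP.+-identityʳ i)))
majBy-∷ʳ R i (a ∷ []) y x =
  cong₂ _+_ (sym (ℕP.+-identityʳ _)) (trans (ℕP.+-identityʳ _) (cong (λ k → if R y x then k else 0) (ℕP.+-comm 1 i)))
majBy-∷ʳ R i (a ∷ b ∷ u) y x = begin
    c + majBy R (suc i) (b ∷ u ++ y ∷ x ∷ [])                                   ≡⟨ cong (c +_) (majBy-∷ʳ R (suc i) (b ∷ u) y x) ⟩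
    c + (majBy R (suc i) (b ∷ u ++ [ y ]) + (if R y x then suc i + length (b ∷ u) else 0)) ≡⟨ sym (ℕP.+-assoc c _ _) ⟩
    (c + majBy R (suc i) (b ∷ u ++ [ y ])) + (if R y x then suc i + length (b ∷ u) else 0)
      ≡⟨ cong (λ k → (c + majBy R (suc i) (b ∷ u ++ [ y ])) + (if R y x then k else 0)) (sym (ℕP.+-suc i _)) ⟩
    (c + majBy R (suc i) (b ∷ u ++ [ y ])) + (if R y x then i + length (a ∷ b ∷ u) else 0) ∎
  where
    open ≡-Reasoning
    c : ℕ
    c = if R a b then i else 0

-- Foata's second fundamental transformation.
--
-- To insert a new last letter x into an already transformed word U whose last
-- letter is y, cut U after every letter lying on the same side of x as y, and in
-- each block so obtained move its last letter to the front; then append x.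
-- We process a word from its end, so the recursion runs on the reversed word.

sameSide : Bool → ℤ → ℤ → Bool
sameSide true  x z = x <ᵇ z
sameSide false x z = z <ᵇ x

-- Block rotation along the test p; acc is the part of the current block read so far.
rotateBlocks : (ℤ → Bool) → List ℤ → List ℤ → List ℤ
rotateBlocks p acc []       = acc
rotateBlocks p acc (y ∷ ys) = if p y then (y ∷ acc) ++ rotateBlocks p [] ys else rotateBlocks p (acc ++ [ y ]) ys

foataRev : List ℤ → List ℤ
foataRev []          = []
foataRev (x ∷ [])    = x ∷ []
foataRev (x ∷ y ∷ r) = rotateBlocks (sameSide (x <ᵇ y) x) [] (foataRev (y ∷ r)) ++ [ x ]

-- L is empty or its last letter passes p: the blocks then exhaust L.
endsPassing : (ℤ → Bool) → List ℤ → Bool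
endsPassing p []          = true
endsPassing p (x ∷ [])    = p x
endsPassing p (x ∷ y ∷ r) = endsPassing p (y ∷ r)

rotateBlocks-↭ : (p : ℤ → Bool) (acc ys : List ℤ) → rotateBlocks p acc ys ↭ acc ++ ys
rotateBlocks-↭ p acc []       = ↭-reflexive (sym (LP.++-identityʳ acc))
rotateBlocks-↭ p acc (y ∷ ys) with p y
... | true  = ↭-trans (prep y (↭P.++⁺ˡ acc (rotateBlocks-↭ p [] ys))) (↭-sym (↭P.shift y acc ys))
... | false = ↭-trans (rotateBlocks-↭ p (acc ++ [ y ]) ys) (↭-reflexive (LP.++-assoc acc [ y ] ys))

foataRev-↭ : (r : List ℤ) → foataRev r ↭ reverse r
foataRev-↭ []          = ↭-refl
foataRev-↭ (x ∷ [])    = ↭-refl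
foataRev-↭ (x ∷ y ∷ r) = ↭-trans (↭P.++⁺ʳ [ x ] (↭-trans (rotateBlocks-↭ _ [] _) (foataRev-↭ (y ∷ r))))
                                  (↭-reflexive (sym (LP.unfold-reverse x (y ∷ r))))

foataRev-∈ : (r : List ℤ) → ∀ {z} → z ∈ foataRev r → z ∈ r
foataRev-∈ r = ↭P.∈-resp-↭ (↭-trans (foataRev-↭ r) (↭P.↭-reverse r))

length-foataRev : (r : List ℤ) → length (foataRev r) ≡ length r
length-foataRev r = trans (↭P.↭-length (foataRev-↭ r)) (LP.length-reverse r)

endsPassing-∷ʳ : (p : ℤ → Bool) (A : List ℤ) (y : ℤ) → endsPassing p (A ++ [ y ]) ≡ p y
endsPassing-∷ʳ p []          y = refl
endsPassing-∷ʳ p (a ∷ [])    y = refl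
endsPassing-∷ʳ p (a ∷ b ∷ A) y = endsPassing-∷ʳ p (b ∷ A) y

endsPassing-++ : (p : ℤ → Bool) (A : List ℤ) (y : ℤ) (ys : List ℤ) → endsPassing p (A ++ y ∷ ys) ≡ endsPassing p (y ∷ ys)
endsPassing-++ p []          y ys = refl
endsPassing-++ p (a ∷ [])    y ys = refl
endsPassing-++ p (a ∷ b ∷ A) y ys = endsPassing-++ p (b ∷ A) y ys

endsPassing-foataRev : (p : ℤ → Bool) (y : ℤ) (r : List ℤ) → endsPassing p (foataRev (y ∷ r)) ≡ p y
endsPassing-foataRev p y []      = refl
endsPassing-foataRev p y (z ∷ r) = endsPassing-∷ʳ p (rotateBlocks (sameSide (y <ᵇ z) y) [] (foataRev (z ∷ r))) y

endsPassing-tail : (p : ℤ → Bool) (y : ℤ) (ys : List ℤ) → endsPassing p (y ∷ ys) ≡ true → endsPassing p ys ≡ true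
endsPassing-tail p y []       e = refl
endsPassing-tail p y (z ∷ ys) e = e

endsPassing-after : (p : ℤ → Bool) (acc : List ℤ) (y : ℤ) (ys : List ℤ) →
  endsPassing p (acc ++ y ∷ ys) ≡ true → endsPassing p ys ≡ true
endsPassing-after p acc y ys e = endsPassing-tail p y ys (trans (sym (endsPassing-++ p acc y ys)) e)

endsPassing-none : (p : ℤ → Bool) (acc : List ℤ) → All (λ a → p a ≡ false) acc → endsPassing p acc ≡ true → acc ≡ []
endsPassing-none p []           _             _ = refl
endsPassing-none p (x ∷ [])     (px ∷ [])     e with () ← trans (sym px) e
endsPassing-none p (x ∷ y ∷ acc) (_ ∷ pacc) e with () ← endsPassing-none p (y ∷ acc) pacc e

endsPassing-assoc : (p : ℤ → Bool) (acc : List ℤ) (y : ℤ) (ys : List ℤ) →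
  endsPassing p (acc ++ y ∷ ys) ≡ true → endsPassing p ((acc ++ [ y ]) ++ ys) ≡ true
endsPassing-assoc p acc y ys = subst (λ L → endsPassing p L ≡ true) (sym (LP.++-assoc acc [ y ] ys))

module _ (p : ℤ → Bool) where

  Separated : (ℤ → ℤ → Bool) → List ℤ → Set
  Separated R L = ∀ {a b} → a ∈ L → b ∈ L → p a ≡ false → p b ≡ true → R a b ≡ true

  private
    q : ℤ → Bool
    q z = not (p z)

    cross-rotate : (y : ℤ) (acc ys : List ℤ) → cross (y ∷ acc) (rotateBlocks p [] ys) ≡ cross (acc ++ [ y ]) ys
    cross-rotate y acc ys = cross-↭ (↭P.∷↭∷ʳ y acc) (rotateBlocks-↭ p [] ys)

    inv-block : (acc : List ℤ) (y : ℤ) (ys : List ℤ) →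
      inv (acc ++ y ∷ ys) ≡ (inv (acc ++ [ y ]) + cross (acc ++ [ y ]) ys) + inv ys
    inv-block acc y ys = trans (cong inv (sym (LP.++-assoc acc [ y ] ys))) (inv-++ (acc ++ [ y ]) ys)

    cnt-q-block : (acc : List ℤ) (y : ℤ) (ys : List ℤ) → p y ≡ true → All (λ a → p a ≡ false) acc →
      cnt q (acc ++ y ∷ ys) ≡ length acc + cnt q ys
    cnt-q-block acc y ys py pacc rewrite cnt-++ q acc (y ∷ ys) | py =
      cong (_+ cnt q ys) (cnt-all-true q acc (All.map (cong not) pacc))

    separated-rest : ∀ {R} acc y ys → Separated R (acc ++ y ∷ ys) → Separated R ys
    separated-rest acc y ys sep ma mb = sep (∈P.∈-++⁺ʳ acc (there ma)) (∈P.∈-++⁺ʳ acc (there mb))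

    separated-assoc : ∀ {R} acc y ys → Separated R (acc ++ y ∷ ys) → Separated R ((acc ++ [ y ]) ++ ys)
    separated-assoc acc y ys sep ma mb = sep (as ma) (as mb)
      where
        as : ∀ {z} → z ∈ (acc ++ [ y ]) ++ ys → z ∈ acc ++ y ∷ ys
        as = subst (_ ∈_) (LP.++-assoc acc [ y ] ys)

    separated-block : ∀ {R} acc y ys → Separated R (acc ++ y ∷ ys) → All (λ a → p a ≡ false) acc → p y ≡ true →
      All (λ a → R a y ≡ true) acc
    separated-block acc y ys sep pacc py =
      All.tabulate (λ ma → sep (∈P.∈-++⁺ˡ ma) (∈P.∈-++⁺ʳ acc (here refl)) (All.lookup pacc ma) py)

  -- If the cutting letters lie above the others, every non-cutting letter gains
  -- one inversion with the cutting letter moved in front of it.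
  inv-rotateBlocks-up : (acc ys : List ℤ) → Separated (λ a b → b >ᵇ a) (acc ++ ys) →
    All (λ a → p a ≡ false) acc → endsPassing p (acc ++ ys) ≡ true →
    inv (rotateBlocks p acc ys) ≡ inv (acc ++ ys) + cnt q (acc ++ ys)
  inv-rotateBlocks-up acc [] sep pacc ends
    with refl ← endsPassing-none p acc pacc (subst (λ L → endsPassing p L ≡ true) (LP.++-identityʳ acc) ends) = refl
  inv-rotateBlocks-up acc (y ∷ ys) sep pacc ends with p y in py
  ... | true = begin
      inv ((y ∷ acc) ++ G) ≡⟨ inv-++ (y ∷ acc) G ⟩
      (inv (y ∷ acc) + cross (y ∷ acc) G) + inv G
        ≡⟨ cong₂ (λ a b → (a + b) + inv G) y-above (cross-rotate y acc ys) ⟩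
      ((length acc + inv acc) + X) + inv G
        ≡⟨ cong (((length acc + inv acc) + X) +_) (inv-rotateBlocks-up [] ys (separated-rest acc y ys sep) [] (endsPassing-after p acc y ys ends)) ⟩
      ((length acc + inv acc) + X) + (inv ys + cnt q ys)
        ≡⟨ solve 5 (λ L I X J C → ((L :+ I) :+ X) :+ (J :+ C) := ((I :+ X) :+ J) :+ (L :+ C)) refl (length acc) (inv acc) X (inv ys) (cnt q ys) ⟩
      ((inv acc + X) + inv ys) + (length acc + cnt q ys)
        ≡⟨ sym (cong₂ (λ a b → (a + X) + inv ys + b) y-last (cnt-q-block acc y ys py pacc)) ⟩
      ((inv (acc ++ [ y ]) + X) + inv ys) + cnt q (acc ++ y ∷ ys) ≡⟨ cong (_+ cnt q (acc ++ y ∷ ys)) (sym (inv-block acc y ys)) ⟩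
      inv (acc ++ y ∷ ys) + cnt q (acc ++ y ∷ ys) ∎
    where
      open ≡-Reasoning
      G : List ℤ
      G = rotateBlocks p [] ys
      X : ℕ
      X = cross (acc ++ [ y ]) ys
      acc<y : All (λ a → (y >ᵇ a) ≡ true) acc
      acc<y = separated-block acc y ys sep pacc py
      y-above : inv (y ∷ acc) ≡ length acc + inv acc
      y-above = trans (inv-∷ y acc) (cong (_+ inv acc) (cnt-all-true _ acc acc<y))
      y-last : inv (acc ++ [ y ]) ≡ inv acc
      y-last = trans (inv-∷ʳ acc y) (trans (cong (inv acc +_) (cnt-all-false _ acc (All.map <ᵇ-asym acc<y))) (ℕP.+-identityʳ _))
  ... | false = subst (λ L → inv (rotateBlocks p (acc ++ [ y ]) ys) ≡ inv L + cnt q L) (LP.++-assoc acc [ y ] ys)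
      (inv-rotateBlocks-up (acc ++ [ y ]) ys (separated-assoc acc y ys sep) (AllP.++⁺ pacc (py ∷ []))
         (endsPassing-assoc p acc y ys ends))

  -- If the cutting letters lie below the others, every non-cutting letter loses
  -- its inversion with the cutting letter moved in front of it.
  inv-rotateBlocks-down : (acc ys : List ℤ) → Separated (λ a b → a >ᵇ b) (acc ++ ys) →
    All (λ a → p a ≡ false) acc → endsPassing p (acc ++ ys) ≡ true →
    inv (rotateBlocks p acc ys) + cnt q (acc ++ ys) ≡ inv (acc ++ ys)
  inv-rotateBlocks-down acc [] sep pacc ends
    with refl ← endsPassing-none p acc pacc (subst (λ L → endsPassing p L ≡ true) (LP.++-identityʳ acc) ends) = refl
  inv-rotateBlocks-down acc (y ∷ ys) sep pacc ends with p y in py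
  ... | true = begin
      inv ((y ∷ acc) ++ G) + cnt q (acc ++ y ∷ ys)
        ≡⟨ cong₂ _+_ (inv-++ (y ∷ acc) G) (cnt-q-block acc y ys py pacc) ⟩
      ((inv (y ∷ acc) + cross (y ∷ acc) G) + inv G) + (length acc + cnt q ys)
        ≡⟨ cong₂ (λ a b → ((a + b) + inv G) + (length acc + cnt q ys)) y-below (cross-rotate y acc ys) ⟩
      ((inv acc + X) + inv G) + (length acc + cnt q ys)
        ≡⟨ solve 5 (λ I X G L C → ((I :+ X) :+ G) :+ (L :+ C) := ((I :+ L) :+ X) :+ (G :+ C)) refl (inv acc) X (inv G) (length acc) (cnt q ys) ⟩
      ((inv acc + length acc) + X) + (inv G + cnt q ys)
        ≡⟨ cong₂ (λ a b → (a + X) + b) (sym y-last)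
                 (inv-rotateBlocks-down [] ys (separated-rest acc y ys sep) [] (endsPassing-after p acc y ys ends)) ⟩
      (inv (acc ++ [ y ]) + X) + inv ys ≡⟨ sym (inv-block acc y ys) ⟩
      inv (acc ++ y ∷ ys) ∎
    where
      open ≡-Reasoning
      G : List ℤ
      G = rotateBlocks p [] ys
      X : ℕ
      X = cross (acc ++ [ y ]) ys
      acc>y : All (λ a → (a >ᵇ y) ≡ true) acc
      acc>y = separated-block acc y ys sep pacc py
      y-below : inv (y ∷ acc) ≡ inv acc
      y-below = trans (inv-∷ y acc) (cong (_+ inv acc) (cnt-all-false _ acc (All.map <ᵇ-asym acc>y)))
      y-last : inv (acc ++ [ y ]) ≡ inv acc + length acc
      y-last = trans (inv-∷ʳ acc y) (cong (inv acc +_) (cnt-all-true _ acc acc>y))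
  ... | false = subst (λ L → inv (rotateBlocks p (acc ++ [ y ]) ys) + cnt q L ≡ inv L) (LP.++-assoc acc [ y ] ys)
      (inv-rotateBlocks-down (acc ++ [ y ]) ys (separated-assoc acc y ys sep) (AllP.++⁺ pacc (py ∷ []))
         (endsPassing-assoc p acc y ys ends))

-- Inserting x into the transformed word U of (y ∷ r) adds |U| inversions if
-- x < y and none otherwise; these are the contributions of x to maj.
inv-insert : (x y : ℤ) (r : List ℤ) → All (x ≢_) (y ∷ r) →
  inv (foataRev (x ∷ y ∷ r)) ≡ inv (foataRev (y ∷ r)) + (if x <ᵇ y then length (y ∷ r) else 0)
inv-insert x y r x∉ with x <ᵇ y in x<y
... | true = begin
    inv (G ++ [ x ])                   ≡⟨ inv-∷ʳ G x ⟩
    inv G + cnt p G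
      ≡⟨ cong₂ _+_ (inv-rotateBlocks-up p [] U (λ _ _ → ≮-<-trans) [] ends) (cnt-↭ p (rotateBlocks-↭ p [] U)) ⟩
    (inv U + cnt (not ∘ p) U) + cnt p U ≡⟨ trans (ℕP.+-assoc (inv U) _ _) (cong (inv U +_) (cnt-not p U)) ⟩
    inv U + length U                   ≡⟨ cong (inv U +_) (length-foataRev (y ∷ r)) ⟩
    inv U + length (y ∷ r)             ∎
  where
    open ≡-Reasoning
    U : List ℤ
    U = foataRev (y ∷ r)
    p : ℤ → Bool
    p = sameSide true x
    G : List ℤ
    G = rotateBlocks p [] U
    ends : endsPassing p U ≡ true
    ends = trans (endsPassing-foataRev p y r) x<y
... | false = begin
    inv (G ++ [ x ])                    ≡⟨ inv-∷ʳ G x ⟩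
    inv G + cnt (_>ᵇ x) G               ≡⟨ cong (inv G +_) (cnt-↭ _ (rotateBlocks-↭ p [] U)) ⟩
    inv G + cnt (_>ᵇ x) U               ≡⟨ cong (inv G +_) (cnt-cong U (λ m → <ᵇ-flip (x≢ m))) ⟩
    inv G + cnt (not ∘ p) U             ≡⟨ inv-rotateBlocks-down p [] U (λ _ _ e₁ e₂ → <-≮-trans e₂ e₁) [] ends ⟩
    inv U                               ≡⟨ sym (ℕP.+-identityʳ _) ⟩
    inv U + 0                           ∎
  where
    open ≡-Reasoning
    U : List ℤ
    U = foataRev (y ∷ r)
    p : ℤ → Bool
    p = sameSide false x
    G : List ℤ
    G = rotateBlocks p [] U
    x≢ : ∀ {z} → z ∈ U → x ≢ z
    x≢ m = All.lookup x∉ (foataRev-∈ (y ∷ r) m)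
    ends : endsPassing p U ≡ true
    ends = trans (endsPassing-foataRev p y r) (trans (<ᵇ-flip (All.lookup x∉ (here refl) ∘ sym)) (cong not x<y))

inv-foataRev : (r : List ℤ) → Unique r → inv (foataRev r) ≡ maj (reverse r)
inv-foataRev []          _ = refl
inv-foataRev (x ∷ [])    _ = refl
inv-foataRev (x ∷ y ∷ r) (x∉ ∷ u) = begin
    inv (foataRev (x ∷ y ∷ r))                                        ≡⟨ inv-insert x y r x∉ ⟩
    inv (foataRev (y ∷ r)) + (if x <ᵇ y then length (y ∷ r) else 0)
      ≡⟨ cong₂ (λ a k → a + (if x <ᵇ y then k else 0)) (inv-foataRev (y ∷ r) u) len ⟩
    maj (reverse (y ∷ r)) + (if y >ᵇ x then 1 + length (reverse r) else 0)
      ≡⟨ cong (_+ (if y >ᵇ x then 1 + length (reverse r) else 0)) (trans (cong maj (LP.unfold-reverse y r)) (majFrom≡majBy 1 (reverse r ++ [ y ]))) ⟩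
    majBy _>ᵇ_ 1 (reverse r ++ [ y ]) + (if y >ᵇ x then 1 + length (reverse r) else 0)
      ≡⟨ sym (majBy-∷ʳ _>ᵇ_ 1 (reverse r) y x) ⟩
    majBy _>ᵇ_ 1 (reverse r ++ y ∷ x ∷ [])                            ≡⟨ sym (majFrom≡majBy 1 (reverse r ++ y ∷ x ∷ [])) ⟩
    maj (reverse r ++ y ∷ x ∷ [])                                     ≡⟨ cong maj (sym reverse-xy) ⟩
    maj (reverse (x ∷ y ∷ r))                                         ∎
  where
    open ≡-Reasoning
    len : length (y ∷ r) ≡ 1 + length (reverse r)
    len = cong suc (sym (LP.length-reverse r))
    reverse-xy : reverse (x ∷ y ∷ r) ≡ reverse r ++ y ∷ x ∷ []
    reverse-xy = trans (LP.unfold-reverse x (y ∷ r)) (trans (cong (_++ [ x ]) (LP.unfold-reverse y r)) (LP.++-assoc (reverse r) [ y ] [ x ]))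

-- A left inverse of the block rotation: each block of the rotated word starts with
-- its cutting letter, which is moved back to the end of the block.  The letter z
-- is the pending cutting letter, A the rest of its block.
unrotateBlocks : (ℤ → Bool) → ℤ → List ℤ → List ℤ → List ℤ
unrotateBlocks p z A []       = A ++ [ z ]
unrotateBlocks p z A (w ∷ ws) = if p w then A ++ z ∷ unrotateBlocks p w [] ws else unrotateBlocks p z (A ++ [ w ]) ws

module _ (p : ℤ → Bool) where

  unrotateBlocks-skip : (z : ℤ) (A N R : List ℤ) → All (λ a → p a ≡ false) N →
    unrotateBlocks p z A (N ++ R) ≡ unrotateBlocks p z (A ++ N) R
  unrotateBlocks-skip z A []      R []       = cong (λ B → unrotateBlocks p z B R) (sym (LP.++-identityʳ A))
  unrotateBlocks-skip z A (w ∷ N) R (e ∷ es) rewrite e =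
    trans (unrotateBlocks-skip z (A ++ [ w ]) N R es) (cong (λ B → unrotateBlocks p z B R) (LP.++-assoc A [ w ] N))

  unrotate-rotate : (acc ys : List ℤ) → All (λ a → p a ≡ false) acc → endsPassing p (acc ++ ys) ≡ true →
    ∀ z A → unrotateBlocks p z A (rotateBlocks p acc ys) ≡ A ++ z ∷ (acc ++ ys)
  unrotate-rotate acc [] pacc ends z A
    with refl ← endsPassing-none p acc pacc (subst (λ L → endsPassing p L ≡ true) (LP.++-identityʳ acc) ends) = refl
  unrotate-rotate acc (y ∷ ys) pacc ends z A with p y in py
  ... | true rewrite py = cong (λ B → A ++ z ∷ B)
          (trans (unrotateBlocks-skip y [] acc (rotateBlocks p [] ys) pacc)
                 (unrotate-rotate [] ys [] (endsPassing-after p acc y ys ends) y acc))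
  ... | false = trans (unrotate-rotate (acc ++ [ y ]) ys (AllP.++⁺ pacc (py ∷ [])) (endsPassing-assoc p acc y ys ends) z A)
                      (cong (λ B → A ++ z ∷ B) (LP.++-assoc acc [ y ] ys))

  rotateBlocks-injective : (u u′ : List ℤ) → endsPassing p u ≡ true → endsPassing p u′ ≡ true →
    rotateBlocks p [] u ≡ rotateBlocks p [] u′ → u ≡ u′
  rotateBlocks-injective u u′ ends ends′ e = proj₂ (LP.∷-injective (begin
      ℤ.+ 0 ∷ u                                                 ≡⟨ sym (unrotate-rotate [] u [] ends (ℤ.+ 0) []) ⟩
      unrotateBlocks p (ℤ.+ 0) [] (rotateBlocks p [] u)         ≡⟨ cong (unrotateBlocks p (ℤ.+ 0) []) e ⟩
      unrotateBlocks p (ℤ.+ 0) [] (rotateBlocks p [] u′)        ≡⟨ unrotate-rotate [] u′ [] ends′ (ℤ.+ 0) [] ⟩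
      ℤ.+ 0 ∷ u′                                                ∎))
    where open ≡-Reasoning

  startsPassing : List ℤ → Bool
  startsPassing []      = false
  startsPassing (z ∷ _) = p z

  startsPassing-rotate : (acc ys : List ℤ) → ys ≢ [] → All (λ a → p a ≡ false) acc → endsPassing p (acc ++ ys) ≡ true →
    startsPassing (rotateBlocks p acc ys) ≡ true
  startsPassing-rotate acc [] ys≢[] _ _ = ⊥-elim (ys≢[] refl)
  startsPassing-rotate acc (y ∷ ys) _ pacc ends with p y in py
  ... | true = py
  startsPassing-rotate acc (y ∷ []) _ pacc ends | false
    with () ← trans (sym (trans (endsPassing-++ p acc y []) py)) ends
  startsPassing-rotate acc (y ∷ y′ ∷ ys) _ pacc ends | false =
    startsPassing-rotate (acc ++ [ y ]) (y′ ∷ ys) (λ ()) (AllP.++⁺ pacc (py ∷ [])) (endsPassing-assoc p acc y (y′ ∷ ys) ends)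

foataRev-nonempty : (y : ℤ) (r : List ℤ) → foataRev (y ∷ r) ≢ []
foataRev-nonempty y r e with () ← trans (sym (length-foataRev (y ∷ r))) (cong length e)

rotate-sides-injective : (x : ℤ) (b b′ : Bool) (U U′ : List ℤ) → U ≢ [] → U′ ≢ [] →
  endsPassing (sameSide b x) U ≡ true → endsPassing (sameSide b′ x) U′ ≡ true →
  rotateBlocks (sameSide b x) [] U ≡ rotateBlocks (sameSide b′ x) [] U′ → U ≡ U′
rotate-sides-injective x true  true  U U′ _ _ ends ends′ e = rotateBlocks-injective (sameSide true x) U U′ ends ends′ e
rotate-sides-injective x false false U U′ _ _ ends ends′ e = rotateBlocks-injective (sameSide false x) U U′ ends ends′ e
rotate-sides-injective x true false U U′ U≢[] U′≢[] ends ends′ e =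
  ⊥-elim (opposite (rotateBlocks (sameSide false x) [] U′)
           (subst (λ L → startsPassing (sameSide true x) L ≡ true) e (startsPassing-rotate _ [] U U≢[] [] ends))
           (startsPassing-rotate _ [] U′ U′≢[] [] ends′))
  where
    opposite : (L : List ℤ) → startsPassing (sameSide true x) L ≡ true → startsPassing (sameSide false x) L ≡ true → ⊥
    opposite (z ∷ L) above below with () ← trans (sym (<ᵇ-asym above)) below
rotate-sides-injective x false true U U′ U≢[] U′≢[] ends ends′ e =
  sym (rotate-sides-injective x true false U′ U U′≢[] U≢[] ends′ ends (sym e))

foataRev-injective : (r r′ : List ℤ) → Unique r → Unique r′ → foataRev r ≡ foataRev r′ → r ≡ r′
foataRev-injective []      []       _ _ _ = refl
foataRev-injective []      (x ∷ r′) _ _ e = ⊥-elim (foataRev-nonempty x r′ (sym e))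
foataRev-injective (x ∷ r) []       _ _ e = ⊥-elim (foataRev-nonempty x r e)
foataRev-injective (x ∷ []) (x′ ∷ []) _ _ refl = refl
foataRev-injective (x ∷ []) (x′ ∷ y′ ∷ r′) _ _ e
  with () ← trans (cong length e) (length-foataRev (x′ ∷ y′ ∷ r′))
foataRev-injective (x ∷ y ∷ r) (x′ ∷ []) _ _ e
  with () ← trans (sym (length-foataRev (x ∷ y ∷ r))) (cong length e)
foataRev-injective (x ∷ y ∷ r) (x′ ∷ y′ ∷ r′) (x∉ ∷ u) (x′∉ ∷ u′) e
  with eG , refl ← LP.∷ʳ-injective _ _ e =
  cong (x ∷_) (foataRev-injective (y ∷ r) (y′ ∷ r′) u u′
    (rotate-sides-injective x (x <ᵇ y) (x <ᵇ y′) _ _ (foataRev-nonempty y r) (foataRev-nonempty y′ r′)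
       (ends y r x∉) (ends y′ r′ x′∉) eG))
  where
    ends : ∀ z s → All (x ≢_) (z ∷ s) → endsPassing (sameSide (x <ᵇ z) x) (foataRev (z ∷ s)) ≡ true
    ends z s x∉ = trans (endsPassing-foataRev _ z s) (side (x <ᵇ z) refl)
      where
        side : ∀ b → (x <ᵇ z) ≡ b → sameSide b x z ≡ true
        side true  e = e
        side false e = trans (<ᵇ-flip (All.lookup x∉ (here refl) ∘ sym)) (cong not e)

select : (ℤ → Bool) → List ℤ → List ℤ
select q []       = []
select q (x ∷ xs) = if q x then x ∷ select q xs else select q xs

select-++ : (q : ℤ → Bool) (A B : List ℤ) → select q (A ++ B) ≡ select q A ++ select q B
select-++ q []      B = refl
select-++ q (a ∷ A) B with q a
... | true  = cong (a ∷_) (select-++ q A B)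
... | false = select-++ q A B

select-none : (q : ℤ → Bool) (A : List ℤ) → All (λ a → q a ≡ false) A → select q A ≡ []
select-none q []      []       = refl
select-none q (a ∷ A) (e ∷ es) rewrite e = select-none q A es

select-rotateBlocks : (q p : ℤ → Bool) (acc ys : List ℤ) →
  (∀ {a b} → a ∈ acc ++ ys → b ∈ acc ++ ys → q a ≡ true → q b ≡ true → p a ≡ p b) →
  All (λ a → p a ≡ false) acc → select q (rotateBlocks p acc ys) ≡ select q (acc ++ ys)
select-rotateBlocks q p acc [] _ _ = cong (select q) (sym (LP.++-identityʳ acc))
select-rotateBlocks q p acc (y ∷ ys) same pacc with p y in py
... | true = begin
    select q (y ∷ acc ++ rotateBlocks p [] ys)              ≡⟨ select-++ q (y ∷ acc) _ ⟩
    select q (y ∷ acc) ++ select q (rotateBlocks p [] ys)  ≡⟨ cong₂ _++_ block rest ⟩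
    select q (acc ++ [ y ]) ++ select q ys                 ≡⟨ sym (select-++ q (acc ++ [ y ]) ys) ⟩
    select q ((acc ++ [ y ]) ++ ys)                        ≡⟨ cong (select q) (LP.++-assoc acc [ y ] ys) ⟩
    select q (acc ++ y ∷ ys)                               ∎
  where
    open ≡-Reasoning
    rest : select q (rotateBlocks p [] ys) ≡ select q ys
    rest = select-rotateBlocks q p [] ys (λ ma mb → same (∈P.∈-++⁺ʳ acc (there ma)) (∈P.∈-++⁺ʳ acc (there mb))) []
    -- a selected cutting letter y forces the rest of its block to be unselected
    block : select q (y ∷ acc) ≡ select q (acc ++ [ y ])
    block with q y in qy
    ... | false = sym (trans (select-++ q acc [ y ]) (trans (cong (select q acc ++_) (select-none q [ y ] (qy ∷ [])))
                    (LP.++-identityʳ _)))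
    ... | true = trans (cong (y ∷_) none) (sym (trans (select-++ q acc [ y ]) (cong₂ _++_ none y-selected)))
      where
        y-selected : select q [ y ] ≡ [ y ]
        y-selected rewrite qy = refl
        unselected : ∀ {a} → a ∈ acc → q a ≡ false
        unselected {a} ma with q a in qa
        ... | false = refl
        ... | true with () ← trans (trans (sym (All.lookup pacc ma)) (same (∈P.∈-++⁺ˡ ma) (∈P.∈-++⁺ʳ acc (here refl)) qa qy)) py
        none : select q acc ≡ []
        none = select-none q acc (All.tabulate unselected)
... | false = trans (select-rotateBlocks q p (acc ++ [ y ]) ys (λ ma mb → same (as ma) (as mb)) (AllP.++⁺ pacc (py ∷ [])))
                    (cong (select q) (LP.++-assoc acc [ y ] ys))
  where
    as : ∀ {z} → z ∈ (acc ++ [ y ]) ++ ys → z ∈ acc ++ y ∷ ys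
    as = subst (_ ∈_) (LP.++-assoc acc [ y ] ys)

Unseparated : (ℤ → Bool) → Set
Unseparated q = ∀ x c d → q c ≡ true → q d ≡ true → c ≢ x → d ≢ x →
  ((x <ᵇ c) ≡ (x <ᵇ d)) × ((c <ᵇ x) ≡ (d <ᵇ x))

select-foataRev : (q : ℤ → Bool) → Unseparated q → (r : List ℤ) → Unique r →
  select q (foataRev r) ≡ select q (reverse r)
select-foataRev q unsep []          _ = refl
select-foataRev q unsep (x ∷ [])    _ = refl
select-foataRev q unsep (x ∷ y ∷ r) (x∉ ∷ u) = begin
    select q (G ++ [ x ])                        ≡⟨ select-++ q G [ x ] ⟩
    select q G ++ select q [ x ]                 ≡⟨ cong (_++ select q [ x ]) (select-rotateBlocks q p [] U same []) ⟩
    select q U ++ select q [ x ]                 ≡⟨ cong (_++ select q [ x ]) (select-foataRev q unsep (y ∷ r) u) ⟩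
    select q (reverse (y ∷ r)) ++ select q [ x ] ≡⟨ sym (select-++ q (reverse (y ∷ r)) [ x ]) ⟩
    select q (reverse (y ∷ r) ++ [ x ])          ≡⟨ cong (select q) (sym (LP.unfold-reverse x (y ∷ r))) ⟩
    select q (reverse (x ∷ y ∷ r))               ∎
  where
    open ≡-Reasoning
    U : List ℤ
    U = foataRev (y ∷ r)
    p : ℤ → Bool
    p = sameSide (x <ᵇ y) x
    G : List ℤ
    G = rotateBlocks p [] U
    x∉U : ∀ {z} → z ∈ U → z ≢ x
    x∉U m = All.lookup x∉ (foataRev-∈ (y ∷ r) m) ∘ sym
    side : ∀ b {c d} → ((x <ᵇ c) ≡ (x <ᵇ d)) × ((c <ᵇ x) ≡ (d <ᵇ x)) → sameSide b x c ≡ sameSide b x d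
    side true  = proj₁
    side false = proj₂
    same : ∀ {a b} → a ∈ [] ++ U → b ∈ [] ++ U → q a ≡ true → q b ≡ true → p a ≡ p b
    same ma mb qa qb = side (x <ᵇ y) (unsep x _ _ qa qb (x∉U ma) (x∉U mb))

rotateBlocks-map : (f : ℤ → ℤ) (p p′ : ℤ → Bool) (acc ys : List ℤ) → (∀ {z} → z ∈ ys → p′ (f z) ≡ p z) →
  rotateBlocks p′ (map f acc) (map f ys) ≡ map f (rotateBlocks p acc ys)
rotateBlocks-map f p p′ acc []       _ = refl
rotateBlocks-map f p p′ acc (y ∷ ys) h rewrite h (here refl) with p y
... | true  = trans (cong (λ L → f y ∷ map f acc ++ L) (rotateBlocks-map f p p′ [] ys (h ∘ there)))
                    (sym (cong (f y ∷_) (LP.map-++ f acc _)))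
... | false = trans (cong (λ A → rotateBlocks p′ A (map f ys)) (sym (LP.map-++ f acc [ y ])))
                    (rotateBlocks-map f p p′ (acc ++ [ y ]) ys (h ∘ there))

foataRev-map : (f : ℤ → ℤ) (r : List ℤ) → OrderPreserving f r → foataRev (map f r) ≡ map f (foataRev r)
foataRev-map f []          _  = refl
foataRev-map f (x ∷ [])    _  = refl
foataRev-map f (x ∷ y ∷ r) op = begin
    rotateBlocks (sameSide (f x <ᵇ f y) (f x)) [] (foataRev (f y ∷ map f r)) ++ [ f x ]
      ≡⟨ cong₂ (λ b L → rotateBlocks (sameSide b (f x)) [] L ++ [ f x ]) (op (here refl) (there (here refl)))
               (foataRev-map f (y ∷ r) (λ ma mb → op (there ma) (there mb))) ⟩
    rotateBlocks (sameSide (x <ᵇ y) (f x)) [] (map f U) ++ [ f x ]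
      ≡⟨ cong (_++ [ f x ]) (rotateBlocks-map f _ _ [] U (λ m → side (x <ᵇ y) (there (foataRev-∈ (y ∷ r) m)))) ⟩
    map f (rotateBlocks (sameSide (x <ᵇ y) x) [] U) ++ [ f x ] ≡⟨ sym (LP.map-++ f _ [ x ]) ⟩
    map f (rotateBlocks (sameSide (x <ᵇ y) x) [] U ++ [ x ])   ∎
  where
    open ≡-Reasoning
    U : List ℤ
    U = foataRev (y ∷ r)
    side : ∀ b {z} → z ∈ x ∷ y ∷ r → sameSide b (f x) (f z) ≡ sameSide b x z
    side true  mz = op (here refl) mz
    side false mz = op mz (here refl)

foata : List ℤ → List ℤ
foata w = foataRev (reverse w)

reverse-unique : {w : List ℤ} → Unique w → Unique (reverse w)
reverse-unique {w} = unique-↭ (↭-sym (↭P.↭-reverse w))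

foata-↭ : (w : List ℤ) → foata w ↭ w
foata-↭ w = ↭-trans (foataRev-↭ (reverse w)) (↭-reflexive (LP.reverse-involutive w))

foata-injective : (w w′ : List ℤ) → Unique w → Unique w′ → foata w ≡ foata w′ → w ≡ w′
foata-injective w w′ u u′ e = LP.reverse-injective (foataRev-injective (reverse w) (reverse w′) (reverse-unique u) (reverse-unique u′) e)

inv-foata : (w : List ℤ) → Unique w → inv (foata w) ≡ maj w
inv-foata w u = trans (inv-foataRev (reverse w) (reverse-unique u)) (cong maj (LP.reverse-involutive w))

foata-map : (f : ℤ → ℤ) (w : List ℤ) → OrderPreserving f w → foata (map f w) ≡ map f (foata w)
foata-map f w op = trans (cong foataRev (sym (LP.reverse-map f w))) (foataRev-map f (reverse w) (λ ma mb → op (rev ma) (rev mb)))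
  where
    rev : ∀ {z} → z ∈ reverse w → z ∈ w
    rev = ↭P.∈-resp-↭ (↭P.↭-reverse w)

select-foata : (q : ℤ → Bool) → Unseparated q → (w : List ℤ) → Unique w → select q (foata w) ≡ select q w
select-foata q unsep w u = trans (select-foataRev q unsep (reverse w) (reverse-unique u)) (cong (select q) (LP.reverse-involutive w))

-- Position of v in L (counting from 0), and the entry of L at position k.
pos : List ℤ → ℤ → ℕ
pos []      v = 0
pos (x ∷ L) v = if ⌊ x ℤ.≟ v ⌋ then 0 else suc (pos L v)

nth : List ℤ → ℕ → ℤ
nth []      k       = ℤ.+ 0
nth (x ∷ L) zero    = x
nth (x ∷ L) (suc k) = nth L k

pos-head : (x : ℤ) (L : List ℤ) → pos (x ∷ L) x ≡ 0
pos-head x L with x ℤ.≟ x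
... | yes _   = refl
... | no x≢x = ⊥-elim (x≢x refl)

pos-tail : (x b : ℤ) (L : List ℤ) → x ≢ b → pos (x ∷ L) b ≡ suc (pos L b)
pos-tail x b L x≢b with x ℤ.≟ b
... | yes x≡b = ⊥-elim (x≢b x≡b)
... | no _    = refl

pos-< : (L : List ℤ) {v : ℤ} → v ∈ L → pos L v < length L
pos-< (x ∷ L) {v} m with x ℤ.≟ v
... | yes _ = s≤s z≤n
pos-< (x ∷ L) (here refl) | no x≢v = ⊥-elim (x≢v refl)
pos-< (x ∷ L) (there m)   | no _   = s≤s (pos-< L m)

nth-pos : (L : List ℤ) {v : ℤ} → v ∈ L → nth L (pos L v) ≡ v
nth-pos (x ∷ L) {v} m with x ℤ.≟ v
... | yes x≡v = x≡v
nth-pos (x ∷ L) (here refl) | no x≢v = ⊥-elim (x≢v refl)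
nth-pos (x ∷ L) (there m)   | no _   = nth-pos L m

nth-∈ : (L : List ℤ) (k : ℕ) → k < length L → nth L k ∈ L
nth-∈ (x ∷ L) zero    _       = here refl
nth-∈ (x ∷ L) (suc k) (s≤s l) = there (nth-∈ L k l)

pos-nth : (L : List ℤ) → Unique L → (k : ℕ) → k < length L → pos L (nth L k) ≡ k
pos-nth (x ∷ L) _       zero    _       = pos-head x L
pos-nth (x ∷ L) (x∉ ∷ u) (suc k) (s≤s l) =
  trans (pos-tail x _ L (All.lookup x∉ (nth-∈ L k l))) (cong suc (pos-nth L u k l))

nth-map : (f : ℤ → ℤ) (L : List ℤ) (k : ℕ) → k < length L → nth (map f L) k ≡ f (nth L k)
nth-map f (x ∷ L) zero    _       = refl
nth-map f (x ∷ L) (suc k) (s≤s l) = nth-map f L k l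

nth-ext : (L L′ : List ℤ) → length L ≡ length L′ → (∀ k → k < length L → nth L k ≡ nth L′ k) → L ≡ L′
nth-ext []      []       _ _ = refl
nth-ext (x ∷ L) (x′ ∷ L′) e h = cong₂ _∷_ (h 0 (s≤s z≤n)) (nth-ext L L′ (ℕP.suc-injective e) (λ k l → h (suc k) (s≤s l)))

range : ℕ → List ℤ
range n = map ℤ.+_ (upTo n)

length-range : (n : ℕ) → length (range n) ≡ n
length-range n = trans (LP.length-map ℤ.+_ (upTo n)) (LP.length-upTo n)

∈-range⁻ : (n : ℕ) {v : ℤ} → v ∈ range n → ∃ λ k → (v ≡ ℤ.+ k) × (k < n)
∈-range⁻ n m with k , mk , refl ← ∈P.∈-map⁻ ℤ.+_ m = k , refl , ∈P.∈-upTo⁻ mk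

∈-range⁺ : (n k : ℕ) → k < n → ℤ.+ k ∈ range n
∈-range⁺ n k l = ∈P.∈-map⁺ ℤ.+_ (∈P.∈-upTo⁺ l)

nth-range : (n k : ℕ) → k < n → nth (range n) k ≡ ℤ.+ k
nth-range n k = go id n k
  where
    go : (f : ℕ → ℕ) (n k : ℕ) → k < n → nth (map ℤ.+_ (applyUpTo f n)) k ≡ ℤ.+ f k
    go f (suc n) zero    _       = refl
    go f (suc n) (suc k) (s≤s l) = go (f ∘ suc) n k l

range-unique : (n : ℕ) → Unique (range n)
range-unique n = UniqueP.map⁺ ℤP.+-injective (UniqueP.upTo⁺ n)

record IsPerm (u : List ℤ) : Set where
  field
    unique : Unique u
    ↭range : u ↭ range (length u)

inverse : List ℤ → List ℤ
inverse u = map (λ v → ℤ.+ pos u v) (range (length u))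

length-inverse : (u : List ℤ) → length (inverse u) ≡ length u
length-inverse u = trans (LP.length-map _ (range (length u))) (length-range (length u))

nth-inverse : (u : List ℤ) (j : ℕ) → j < length u → nth (inverse u) j ≡ ℤ.+ pos u (ℤ.+ j)
nth-inverse u j l = trans (nth-map _ (range (length u)) j (subst (j <_) (sym (length-range _)) l))
                          (cong (λ v → ℤ.+ pos u v) (nth-range (length u) j l))

module _ (u : List ℤ) (perm : IsPerm u) where
  open IsPerm perm

  private
    n : ℕ
    n = length u
    range⊆u : ∀ {v} → v ∈ range n → v ∈ u
    range⊆u = ↭P.∈-resp-↭ (↭-sym ↭range)

  inverse-unique : Unique (inverse u)
  inverse-unique = map-unique _ (range-unique n) λ ma mb e →
    trans (sym (nth-pos u (range⊆u ma))) (trans (cong (nth u) (ℤP.+-injective e)) (nth-pos u (range⊆u mb)))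

  inverse-↭ : inverse u ↭ range n
  inverse-↭ = unique-⊆⇒↭ inverse-unique into (ℕP.≤-reflexive (trans (length-range n) (sym (length-inverse u))))
    where
      into : ∀ {z} → z ∈ inverse u → z ∈ range n
      into m with v , mv , refl ← ∈P.∈-map⁻ _ m = ∈-range⁺ n (pos u v) (pos-< u (range⊆u mv))

  -- If u has j at position k, then the inverse has k at position j.
  inverse-involutive : inverse (inverse u) ≡ u
  inverse-involutive = nth-ext _ u (trans (length-inverse (inverse u)) (length-inverse u)) λ k l →
    entry k (subst (k <_) (trans (length-inverse (inverse u)) (length-inverse u)) l)
    where
      entry : ∀ k → k < n → nth (inverse (inverse u)) k ≡ nth u k
      entry k k<n with j , uk≡j , j<n ← ∈-range⁻ n (↭P.∈-resp-↭ ↭range (nth-∈ u k k<n)) = begin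
          nth (inverse (inverse u)) k                 ≡⟨ nth-inverse (inverse u) k (subst (k <_) (sym (length-inverse u)) k<n) ⟩
          ℤ.+ pos (inverse u) (ℤ.+ k)                 ≡⟨ cong (λ z → ℤ.+ pos (inverse u) z) (sym inverse-at-j) ⟩
          ℤ.+ pos (inverse u) (nth (inverse u) j)     ≡⟨ cong ℤ.+_ (pos-nth (inverse u) inverse-unique j (subst (j <_) (sym (length-inverse u)) j<n)) ⟩
          ℤ.+ j                                       ≡⟨ sym uk≡j ⟩
          nth u k                                     ∎
        where
          open ≡-Reasoning
          inverse-at-j : nth (inverse u) j ≡ ℤ.+ k
          inverse-at-j = trans (nth-inverse u j j<n) (cong ℤ.+_ (trans (cong (pos u) (sym uk≡j)) (pos-nth u unique k k<n)))

isInversion : List ℤ → ℤ → ℤ → ℕ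
isInversion L a b = indicator ((pos L a ℕ.<ᵇ pos L b) ∧ (b <ᵇ a))

inv≡sum-isInversion : (L : List ℤ) → Unique L → inv L ≡ sumL (λ a → sumL (isInversion L a) L) L
inv≡sum-isInversion []      _ = refl
inv≡sum-isInversion (x ∷ L) (x∉ ∷ u) = begin
    inv (x ∷ L)                                              ≡⟨ inv-∷ x L ⟩
    cnt (x >ᵇ_) L + inv L                                    ≡⟨ cong₂ _+_ (sumL-cong L (sym ∘ first-x)) (inv≡sum-isInversion L u) ⟩
    sumL (I x) L + sumL (λ a → sumL (isInversion L a) L) L   ≡⟨ cong₂ (λ c d → c + sumL (I x) L + d) (sym x-x) (sumL-cong L (sym ∘ row)) ⟩
    sumL (λ a → sumL (I a) (x ∷ L)) (x ∷ L)                  ∎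
  where
    open ≡-Reasoning
    I : ℤ → ℤ → ℕ
    I = isInversion (x ∷ L)
    x≢ : ∀ {a} → a ∈ L → x ≢ a
    x≢ = All.lookup x∉
    x-x : I x x ≡ 0
    x-x rewrite pos-head x L = refl
    first-x : ∀ {b} → b ∈ L → I x b ≡ indicator (x >ᵇ b)
    first-x {b} m rewrite pos-tail x b L (x≢ m) | pos-head x L = refl
    row : ∀ {a} → a ∈ L → sumL (I a) (x ∷ L) ≡ sumL (isInversion L a) L
    row {a} ma = cong₂ _+_ a-x (sumL-cong L shift)
      where
        a-x : I a x ≡ 0
        a-x rewrite pos-tail x a L (x≢ ma) | pos-head x L = refl
        shift : ∀ {b} → b ∈ L → I a b ≡ isInversion L a b
        shift {b} mb rewrite pos-tail x a L (x≢ ma) | pos-tail x b L (x≢ mb) = refl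

module _ (u : List ℤ) (perm : IsPerm u) where
  open IsPerm perm

  private
    n : ℕ
    n = length u
    I : List ℤ
    I = inverse u
    posAsInt : ℤ → ℤ
    posAsInt = λ v → ℤ.+ pos u v

    range-pos : ∀ {j} → j ∈ range n → j ≡ ℤ.+ pos (range n) j
    range-pos {j} m = trans (sym (nth-pos (range n) m)) (nth-range n (pos (range n) j) (subst (pos (range n) j <_) (length-range n) (pos-< (range n) m)))

    pos-inverse : ∀ {j} → j ∈ range n → pos I (posAsInt j) ≡ pos (range n) j
    pos-inverse {j} m = begin
        pos I (posAsInt j)                                     ≡⟨ cong (pos I ∘ posAsInt) (sym (nth-pos (range n) m)) ⟩
        pos I (posAsInt (nth (range n) (pos (range n) j)))     ≡⟨ cong (pos I) (sym (nth-map posAsInt (range n) _ (pos-< (range n) m))) ⟩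
        pos I (nth I (pos (range n) j))
          ≡⟨ pos-nth I (inverse-unique u perm) _ (subst (pos (range n) j <_) (sym (LP.length-map posAsInt (range n))) (pos-< (range n) m)) ⟩
        pos (range n) j                                        ∎
      where open ≡-Reasoning

    compare-range : ∀ {j k} → j ∈ range n → k ∈ range n → (pos (range n) j ℕ.<ᵇ pos (range n) k) ≡ (j <ᵇ k)
    compare-range mj mk = trans (sym (<ᵇ-ℕ _ _)) (sym (cong₂ _<ᵇ_ (range-pos mj) (range-pos mk)))

  -- (j, k) is an inversion of the inverse iff (k, j) is one of u.
  inv-inverse : inv (inverse u) ≡ inv u
  inv-inverse = begin
      inv I                                                     ≡⟨ inv≡sum-isInversion I (inverse-unique u perm) ⟩
      sumL (λ a → sumL (isInversion I a) I) I                   ≡⟨ sumL-map _ posAsInt (range n) ⟩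
      sumL (λ j → sumL (isInversion I (posAsInt j)) I) (range n) ≡⟨ sumL-cong (range n) (λ _ → sumL-map _ posAsInt (range n)) ⟩
      sumL (λ j → sumL (λ k → isInversion I (posAsInt j) (posAsInt k)) (range n)) (range n)
        ≡⟨ sumL-cong (range n) (λ mj → sumL-cong (range n) (λ mk → transposed mj mk)) ⟩
      sumL (λ j → sumL (λ k → isInversion u k j) (range n)) (range n) ≡⟨ sym (sumL-swap (isInversion u) (range n) (range n)) ⟩
      sumL (λ a → sumL (isInversion u a) (range n)) (range n)   ≡⟨ sym (sumL-↭ _ ↭range) ⟩
      sumL (λ a → sumL (isInversion u a) (range n)) u           ≡⟨ sumL-cong u (λ _ → sym (sumL-↭ _ ↭range)) ⟩
      sumL (λ a → sumL (isInversion u a) u) u                   ≡⟨ sym (inv≡sum-isInversion u unique) ⟩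
      inv u                                                     ∎
    where
      open ≡-Reasoning
      transposed : ∀ {j k} → j ∈ range n → k ∈ range n → isInversion I (posAsInt j) (posAsInt k) ≡ isInversion u k j
      transposed {j} {k} mj mk = cong indicator
        (trans (cong₂ _∧_ (trans (cong₂ ℕ._<ᵇ_ (pos-inverse mj) (pos-inverse mk)) (compare-range mj mk)) (<ᵇ-ℕ (pos u k) (pos u j)))
               (∧-comm (j <ᵇ k) (pos u k ℕ.<ᵇ pos u j)))

  -- The descents of the inverse are the values j such that j+1 occurs before j in u.
  maj-inverse : maj (inverse u) ≡ majBy (λ a b → pos u b ℕ.<ᵇ pos u a) 1 (range n)
  maj-inverse = trans (majFrom≡majBy 1 (map posAsInt (range n)))
    (trans (majBy-map _ posAsInt 1 (range n)) (majBy-cong _ _ 1 (range n) (λ {a} {b} _ → <ᵇ-ℕ (pos u b) (pos u a))))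

isEither : ℤ → ℤ → ℤ → Bool
isEither a b z = ⌊ z ℤ.≟ a ⌋ ∨ ⌊ z ℤ.≟ b ⌋

startsWith : List ℤ → ℤ → Bool
startsWith []      b = false
startsWith (z ∷ _) b = ⌊ z ℤ.≟ b ⌋

≟-refl : ∀ x → ⌊ x ℤ.≟ x ⌋ ≡ true
≟-refl x with x ℤ.≟ x
... | yes _   = refl
... | no x≢x = ⊥-elim (x≢x refl)

≟-≢ : ∀ {x y} → x ≢ y → ⌊ x ℤ.≟ y ⌋ ≡ false
≟-≢ {x} {y} x≢y with x ℤ.≟ y
... | yes x≡y = ⊥-elim (x≢y x≡y)
... | no _    = refl

before≡startsWith : (L : List ℤ) {a b : ℤ} → a ≢ b → a ∈ L → b ∈ L →
  (pos L b ℕ.<ᵇ pos L a) ≡ startsWith (select (isEither a b) L) b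
before≡startsWith (c ∷ L) {a} {b} a≢b ma mb with c ℤ.≟ a | c ℤ.≟ b
... | yes refl | yes refl = ⊥-elim (a≢b refl)
... | yes refl | no c≢b   = sym (≟-≢ c≢b)
... | no _     | yes refl = sym (≟-refl c)
... | no c≢a   | no c≢b   = before≡startsWith L a≢b (in-tail ma c≢a) (in-tail mb c≢b)
  where
    in-tail : ∀ {z} → z ∈ c ∷ L → c ≢ z → z ∈ L
    in-tail (here refl) c≢z = ⊥-elim (c≢z refl)
    in-tail (there m)   _   = m

rank : List ℤ → ℤ → ℤ
rank w v = ℤ.+ cnt (_<ᵇ v) w

standardise : List ℤ → List ℤ
standardise w = map (rank w) w

-- Smaller letters of w have strictly smaller ranks (a itself is counted for b only).
rank-strict : (w : List ℤ) → ∀ {a b} → a ∈ w → a ℤ.< b → cnt (_<ᵇ a) w < cnt (_<ᵇ b) w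
rank-strict w {a} {b} ma a<b =
  cnt-strict (_<ᵇ a) (_<ᵇ b) w (λ y<a → <⇒<ᵇ (ℤP.<-trans (<ᵇ⇒< y<a) a<b)) ma (<ᵇ-irrefl a) (<⇒<ᵇ a<b)

rank-mono : (w : List ℤ) → ∀ {a b} → ¬ a ℤ.< b → cnt (_<ᵇ b) w ≤ cnt (_<ᵇ a) w
rank-mono w a≮b = cnt-mono _ _ w (λ y<b → <⇒<ᵇ (ℤP.<-≤-trans (<ᵇ⇒< y<b) (ℤP.≮⇒≥ a≮b)))

rank-preserves-order : (w : List ℤ) → OrderPreserving (rank w) w
rank-preserves-order w {a} {b} ma mb with a <ᵇ b in a<b
... | true  = trans (<ᵇ-ℕ _ _) (Equivalence.to T-≡ (ℕP.<⇒<ᵇ (rank-strict w ma (<ᵇ⇒< a<b))))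
... | false = ≮⇒<ᵇ≡false (λ { (ℤ.+<+ l) → ℕP.<⇒≱ l (rank-mono w (<ᵇ≡false⇒≮ a<b)) })

rank-injective : (w : List ℤ) → ∀ {a b} → a ∈ w → b ∈ w → rank w a ≡ rank w b → a ≡ b
rank-injective w {a} {b} ma mb e with ℤP.<-cmp a b
... | tri≈ _ a≡b _ = a≡b
... | tri< a<b _ _ = ⊥-elim (ℕP.<-irrefl (ℤP.+-injective e) (rank-strict w ma a<b))
... | tri> _ _ b<a = ⊥-elim (ℕP.<-irrefl (ℤP.+-injective (sym e)) (rank-strict w mb b<a))

rank-< : (w : List ℤ) → ∀ {v} → v ∈ w → cnt (_<ᵇ v) w < length w
rank-< w {v} m = subst (cnt (_<ᵇ v) w <_) (cnt-all-true _ w (All.tabulate (λ _ → refl)))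
  (cnt-strict (_<ᵇ v) (λ _ → true) w (λ _ → refl) m (<ᵇ-irrefl v) refl)

length-standardise : (w : List ℤ) → length (standardise w) ≡ length w
length-standardise w = LP.length-map (rank w) w

standardise-↭ : (w : List ℤ) → Unique w → standardise w ↭ range (length w)
standardise-↭ w u = unique-⊆⇒↭ (map-unique (rank w) u (rank-injective w)) into
  (ℕP.≤-reflexive (trans (length-range _) (sym (length-standardise w))))
  where
    into : ∀ {z} → z ∈ standardise w → z ∈ range (length w)
    into m with v , mv , refl ← ∈P.∈-map⁻ (rank w) m = ∈-range⁺ _ _ (rank-< w mv)

standardise-IsPerm : (w : List ℤ) → Unique w → IsPerm (standardise w)
standardise-IsPerm w u = record
  { unique = map-unique (rank w) u (rank-injective w)
  ; ↭range = subst (λ k → standardise w ↭ range k) (sym (length-standardise w)) (standardise-↭ w u) }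

ofRankIn : List ℤ → List ℤ → ℤ → ℤ
ofRankIn []      w k = ℤ.+ 0
ofRankIn (x ∷ L) w k = if ⌊ rank w x ℤ.≟ k ⌋ then x else ofRankIn L w k

ofRank : List ℤ → ℤ → ℤ
ofRank w = ofRankIn w w

ofRank-rank : (w : List ℤ) → ∀ {v} → v ∈ w → ofRank w (rank w v) ≡ v
ofRank-rank w = search w (λ m → m)
  where
    search : (L : List ℤ) → (∀ {z} → z ∈ L → z ∈ w) → ∀ {v} → v ∈ L → ofRankIn L w (rank w v) ≡ v
    search (x ∷ L) sub {v} m with rank w x ℤ.≟ rank w v
    ... | yes e = rank-injective w (sub (here refl)) (sub m) e
    search (x ∷ L) sub (here refl) | no ne = ⊥-elim (ne refl)
    search (x ∷ L) sub (there m)   | no _  = search L (sub ∘ there) m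

module _ (w : List ℤ) (u : Unique w) where

  private
    n : ℕ
    n = length w

  ofRank-spec : ∀ {k} → k ∈ range n → (ofRank w k ∈ w) × (rank w (ofRank w k) ≡ k)
  ofRank-spec km with v , mv , refl ← ∈P.∈-map⁻ (rank w) (↭P.∈-resp-↭ (↭-sym (standardise-↭ w u)) km) =
    subst (_∈ w) (sym (ofRank-rank w mv)) mv , cong (rank w) (ofRank-rank w mv)

  ofRank-preserves-order : OrderPreserving (ofRank w) (range n)
  ofRank-preserves-order {j} {k} mj mk = begin
      (ofRank w j <ᵇ ofRank w k)                   ≡⟨ sym (rank-preserves-order w (proj₁ (ofRank-spec mj)) (proj₁ (ofRank-spec mk))) ⟩
      (rank w (ofRank w j) <ᵇ rank w (ofRank w k)) ≡⟨ cong₂ _<ᵇ_ (proj₂ (ofRank-spec mj)) (proj₂ (ofRank-spec mk)) ⟩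
      (j <ᵇ k)                                     ∎
    where open ≡-Reasoning

  -- Ranks, hence letters of given rank, do not depend on the order of the letters.
  ofRank-↭ : (w′ : List ℤ) → w′ ↭ w → ∀ {k} → k ∈ range n → ofRank w′ k ≡ ofRank w k
  ofRank-↭ w′ p {k} km = begin
      ofRank w′ k                   ≡⟨ cong (ofRank w′) (sym (proj₂ (ofRank-spec km))) ⟩
      ofRank w′ (rank w (ofRank w k)) ≡⟨ cong (λ z → ofRank w′ (ℤ.+ z)) (sym (cnt-↭ _ p)) ⟩
      ofRank w′ (rank w′ (ofRank w k)) ≡⟨ ofRank-rank w′ (↭P.∈-resp-↭ (↭-sym p) (proj₁ (ofRank-spec km))) ⟩
      ofRank w k                    ∎
    where open ≡-Reasoning

inverseWord : List ℤ → List ℤ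
inverseWord w = map (ofRank w) (inverse (standardise w))

imaj : List ℤ → ℕ
imaj w = maj (inverse (standardise w))

module _ (w : List ℤ) (u : Unique w) where

  private
    n : ℕ
    n = length w
    S : List ℤ
    S = standardise w
    I : List ℤ
    I = inverse S
    perm : IsPerm S
    perm = standardise-IsPerm w u
    I↭range : I ↭ range n
    I↭range = subst (λ k → I ↭ range k) (length-standardise w) (inverse-↭ S perm)
    I⊆range : ∀ {z} → z ∈ I → z ∈ range n
    I⊆range = ↭P.∈-resp-↭ I↭range
    ofRank∘rank : map (ofRank w) S ≡ w
    ofRank∘rank = trans (sym (LP.map-∘ w)) (LP.map-id-local (All.tabulate (ofRank-rank w)))
    ofRank-on-I : OrderPreserving (ofRank w) I
    ofRank-on-I ma mb = ofRank-preserves-order w u (I⊆range ma) (I⊆range mb)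

  inverseWord-↭ : inverseWord w ↭ w
  inverseWord-↭ = ↭-trans (↭P.map⁺ (ofRank w) I↭range)
    (↭-trans (↭P.map⁺ (ofRank w) (↭-sym (standardise-↭ w u))) (↭-reflexive ofRank∘rank))

  standardise-inverseWord : standardise (inverseWord w) ≡ I
  standardise-inverseWord = begin
      map (rank (inverseWord w)) (inverseWord w)  ≡⟨ LP.map-cong-local (All.tabulate (λ _ → cong ℤ.+_ (cnt-↭ _ inverseWord-↭))) ⟩
      map (rank w) (map (ofRank w) I)             ≡⟨ sym (LP.map-∘ I) ⟩
      map (rank w ∘ ofRank w) I                   ≡⟨ LP.map-id-local (All.tabulate (λ m → proj₂ (ofRank-spec w u (I⊆range m)))) ⟩
      I                                           ∎
    where open ≡-Reasoning

  inverseWord-involutive : inverseWord (inverseWord w) ≡ w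
  inverseWord-involutive = begin
      map (ofRank ιw) (inverse (standardise ιw)) ≡⟨ cong (map (ofRank ιw) ∘ inverse) standardise-inverseWord ⟩
      map (ofRank ιw) (inverse I)                ≡⟨ cong (map (ofRank ιw)) (inverse-involutive S perm) ⟩
      map (ofRank ιw) S                          ≡⟨ LP.map-cong-local (All.tabulate same-letters) ⟩
      map (ofRank w) S                           ≡⟨ ofRank∘rank ⟩
      w                                          ∎
    where
      open ≡-Reasoning
      ιw : List ℤ
      ιw = inverseWord w
      same-letters : ∀ {k} → k ∈ S → ofRank ιw k ≡ ofRank w k
      same-letters m = ofRank-↭ w u ιw inverseWord-↭ (↭P.∈-resp-↭ (standardise-↭ w u) m)

  inv-inverseWord : inv (inverseWord w) ≡ inv w
  inv-inverseWord = trans (inv-relabel (ofRank w) I ofRank-on-I)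
                          (trans (inv-inverse S perm) (inv-relabel (rank w) w (rank-preserves-order w)))

  maj-inverseWord : maj (inverseWord w) ≡ imaj w
  maj-inverseWord = maj-relabel (ofRank w) I ofRank-on-I

  imaj-inverseWord : imaj (inverseWord w) ≡ maj w
  imaj-inverseWord = trans (cong (maj ∘ inverse) standardise-inverseWord)
    (trans (cong maj (inverse-involutive S perm)) (maj-relabel (rank w) w (rank-preserves-order w)))

-- Foata's map preserves the inverse major index: the descents of the inverse only
-- depend on the relative order of the letters k, k+1, which nothing separates.

isEither-cases : ∀ {a b c} → isEither a b c ≡ true → (c ≡ a) ⊎ (c ≡ b)
isEither-cases {a} {b} {c} e with c ℤ.≟ a | c ℤ.≟ b
... | yes c≡a | _       = inj₁ c≡a
... | no _    | yes c≡b = inj₂ c≡b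

consecutive-unseparated : (k : ℕ) → Unseparated (isEither (ℤ.+ k) (ℤ.+ suc k))
consecutive-unseparated k x c d qc qd c≢x d≢x with isEither-cases {ℤ.+ k} {ℤ.+ suc k} {c} qc | isEither-cases {ℤ.+ k} {ℤ.+ suc k} {d} qd
... | inj₁ refl | inj₁ refl = refl , refl
... | inj₂ refl | inj₂ refl = refl , refl
... | inj₁ refl | inj₂ refl = between-consecutive x k (c≢x ∘ sym) (d≢x ∘ sym)
... | inj₂ refl | inj₁ refl = Data.Product.map sym sym (between-consecutive x k (d≢x ∘ sym) (c≢x ∘ sym))

Adjacent-range : (n : ℕ) {a b : ℤ} → Adjacent a b (range n) → ∃ λ k → (a ≡ ℤ.+ k) × (b ≡ ℤ.+ suc k)
Adjacent-range n = go id n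
  where
    go : (f : ℕ → ℕ) (n : ℕ) {a b : ℤ} → Adjacent a b (map ℤ.+_ (applyUpTo f n)) → ∃ λ k → (a ≡ ℤ.+ f k) × (b ≡ ℤ.+ f (suc k))
    go f (suc (suc n)) here      = 0 , refl , refl
    go f (suc n)       (there c) with k , e₁ , e₂ ← go (f ∘ suc) n c = suc k , e₁ , e₂

maj-inverse-foata : (s : List ℤ) → IsPerm s → maj (inverse (foata s)) ≡ maj (inverse s)
maj-inverse-foata s perm = begin
    maj (inverse (foata s))                                          ≡⟨ maj-inverse (foata s) perm′ ⟩
    majBy (λ a b → pos (foata s) b ℕ.<ᵇ pos (foata s) a) 1 (range (length (foata s)))
      ≡⟨ cong (λ m → majBy (λ a b → pos (foata s) b ℕ.<ᵇ pos (foata s) a) 1 (range m)) length-foata ⟩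
    majBy (λ a b → pos (foata s) b ℕ.<ᵇ pos (foata s) a) 1 (range n) ≡⟨ majBy-cong _ _ 1 (range n) same-order ⟩
    majBy (λ a b → pos s b ℕ.<ᵇ pos s a) 1 (range n)                 ≡⟨ sym (maj-inverse s perm) ⟩
    maj (inverse s)                                                  ∎
  where
    open ≡-Reasoning
    open IsPerm perm
    n : ℕ
    n = length s
    length-foata : length (foata s) ≡ n
    length-foata = ↭P.↭-length (foata-↭ s)
    perm′ : IsPerm (foata s)
    perm′ = record { unique = unique-↭ (↭-sym (foata-↭ s)) unique
                   ; ↭range = ↭-trans (foata-↭ s) (subst (λ k → s ↭ range k) (sym length-foata) ↭range) }
    range⊆s : ∀ {z} → z ∈ range n → z ∈ s
    range⊆s = ↭P.∈-resp-↭ (↭-sym ↭range)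
    range⊆foata : ∀ {z} → z ∈ range n → z ∈ foata s
    range⊆foata = ↭P.∈-resp-↭ (↭-sym (foata-↭ s)) ∘ range⊆s
    same-order : ∀ {a b} → Adjacent a b (range n) → (pos (foata s) b ℕ.<ᵇ pos (foata s) a) ≡ (pos s b ℕ.<ᵇ pos s a)
    same-order {a} {b} c with k , refl , refl ← Adjacent-range n c = begin
        (pos (foata s) b ℕ.<ᵇ pos (foata s) a)
          ≡⟨ before≡startsWith (foata s) a≢b (range⊆foata (Adjacent⇒∈₁ c)) (range⊆foata (Adjacent⇒∈₂ c)) ⟩
        startsWith (select (isEither a b) (foata s)) b
          ≡⟨ cong (λ L → startsWith L b) (select-foata _ (consecutive-unseparated k) s unique) ⟩
        startsWith (select (isEither a b) s) b
          ≡⟨ sym (before≡startsWith s a≢b (range⊆s (Adjacent⇒∈₁ c)) (range⊆s (Adjacent⇒∈₂ c))) ⟩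
        (pos s b ℕ.<ᵇ pos s a)                     ∎
      where
        a≢b : ℤ.+ k ≢ ℤ.+ suc k
        a≢b e = ℕP.1+n≢n (sym (ℤP.+-injective e))

imaj-foata : (w : List ℤ) → Unique w → imaj (foata w) ≡ imaj w
imaj-foata w u = trans (cong (maj ∘ inverse) standardise-foata) (maj-inverse-foata (standardise w) (standardise-IsPerm w u))
  where
    standardise-foata : standardise (foata w) ≡ foata (standardise w)
    standardise-foata = trans (LP.map-cong-local (All.tabulate (λ _ → cong ℤ.+_ (cnt-↭ _ (foata-↭ w)))))
                              (sym (foata-map (rank w) w (rank-preserves-order w)))

_⊕N₂ : (List ℤ → ℕ) → List ℤ → ℕ
(s ⊕N₂) w = s w + N₂ w

record Rearrangement (σ : List ℤ → List ℤ) : Set where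
  field
    ↭self     : ∀ {w} → Unique w → σ w ↭ w
    injective : ∀ {w w′} → Unique w → Unique w′ → σ w ≡ σ w′ → w ≡ w′

foata-Rearrangement : Rearrangement foata
foata-Rearrangement = record { ↭self = λ {w} _ → foata-↭ w ; injective = foata-injective _ _ }

inverseWord-Rearrangement : Rearrangement inverseWord
inverseWord-Rearrangement = record
  { ↭self = λ {w} u → inverseWord-↭ w u
  ; injective = λ {w} {w′} u u′ e → trans (sym (inverseWord-involutive w u))
                                      (trans (cong inverseWord e) (inverseWord-involutive w′ u′)) }

-- A rearrangement σ permutes D n and fixes N₂, so if it carries the pair of
-- statistics (f, g) to (f′, g′), both shifted pairs have the same distribution on D n.
coeff-transport : (n a b : ℕ) {σ : List ℤ → List ℤ} → Rearrangement σ → (f g f′ g′ : List ℤ → ℕ) →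
  (∀ {w} → Unique w → f′ (σ w) ≡ f w) → (∀ {w} → Unique w → g′ (σ w) ≡ g w) →
  coeff n (f′ ⊕N₂) (g′ ⊕N₂) a b ≡ coeff n (f ⊕N₂) (g ⊕N₂) a b
coeff-transport n a b {σ} re f g f′ g′ f′σ≡f g′σ≡g =
  trans (filter-length-injection (λ γ → ((f′ ⊕N₂) γ ℕ.≟ a) ×-dec ((g′ ⊕N₂) γ ℕ.≟ b)) (D n) σ (D-unique n) into injective-on-D)
        (filter-length-cong _ _ (D n) λ m →
           (λ (e₁ , e₂) → trans (sym (shift f f′ f′σ≡f m)) e₁ , trans (sym (shift g g′ g′σ≡g m)) e₂) ,
           (λ (e₁ , e₂) → trans (shift f f′ f′σ≡f m) e₁ , trans (shift g g′ g′σ≡g m) e₂))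
  where
    open Rearrangement re using (↭self)
    unique : ∀ {w} → w ∈ D n → Unique w
    unique = ∈D⇒Unique n
    into : ∀ {w} → w ∈ D n → σ w ∈ D n
    into m = ∈D-↭ n (↭-sym (↭self (unique m))) m
    injective-on-D : ∀ {w w′} → w ∈ D n → w′ ∈ D n → σ w ≡ σ w′ → w ≡ w′
    injective-on-D m m′ = Rearrangement.injective re (unique m) (unique m′)
    shift : ∀ s s′ → (∀ {w} → Unique w → s′ (σ w) ≡ s w) → ∀ {w} → w ∈ D n → (s′ ⊕N₂) (σ w) ≡ (s ⊕N₂) w
    shift _ _ s′σ≡s m = cong₂ _+_ (s′σ≡s (unique m)) (N₂-↭ (↭self (unique m)))

proposition5p3 : (n : ℕ) → 2 ≤ n → (a b : ℕ) →
    coeff n dmaj ℓD a b ≡ coeff n ℓD dmaj a b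
proposition5p3 n _ a b = begin
    coeff n (maj ⊕N₂)  (inv ⊕N₂)  a b ≡⟨ coeff-transport n a b ι imaj inv  maj  inv  (maj-inverseWord _)  (inv-inverseWord _) ⟩
    coeff n (imaj ⊕N₂) (inv ⊕N₂)  a b ≡⟨ coeff-transport n a b Φ imaj maj  imaj inv  (imaj-foata _)       (inv-foata _) ⟩
    coeff n (imaj ⊕N₂) (maj ⊕N₂)  a b ≡⟨ coeff-transport n a b ι maj  imaj imaj maj  (imaj-inverseWord _) (maj-inverseWord _) ⟩
    coeff n (maj ⊕N₂)  (imaj ⊕N₂) a b ≡⟨ sym (coeff-transport n a b Φ maj imaj inv imaj (inv-foata _) (imaj-foata _)) ⟩
    coeff n (inv ⊕N₂)  (imaj ⊕N₂) a b ≡⟨ coeff-transport n a b ι inv  maj  inv  imaj (inv-inverseWord _) (imaj-inverseWord _) ⟩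
    coeff n (inv ⊕N₂)  (maj ⊕N₂)  a b ∎
  where
    open ≡-Reasoning
    ι : Rearrangement inverseWord
    ι = inverseWord-Rearrangement
    Φ : Rearrangement foata
    Φ = foata-Rearrangement
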